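{- Let $\mathbf F$ be a satisfiable CNF formula, let $\alpha\in\mathrm{sat}(\mathbf F)$ and let $l\in\alpha$. Then $p(\mathbf F^{[l]},\alpha)\ge p(\mathbf F,\alpha)$. If moreover $l$ is a literal over a frozen variable of $\mathbf F$, then $p(\mathbf F^{[l]},\alpha)=p(\mathbf F,\alpha)$ and $c(\mathbf F^{[l]})\le c(\mathbf F)$ (the latter for $\mathbf F$ a $(\le k)$-CNF formula).
   Context: Fix $k\ge3$. A literal is a variable $x$ or its negation $\bar x$; a clause is a finite set of literals over pairwise distinct variables; a CNF formula $\mathbf F=(F,V)$ has variable set $V(\mathbf F)=V$ (finite), $n(\mathbf F)=|V|$, and a finite set $F$ of clauses over $V$; it is $(\le k)$-CNF if all clauses have at most $k$ literals. Assignments on $V$ are maps $V\to\{0,1\}$, identified with the set of literals they satisfy; $\mathrm{sat}(\mathbf F)$ is the set of satisfying assignments on $V(\mathbf F)$. For a literal $l$ over $y\in V(\mathbf F)$, $\mathbf F^{[l]}$ deletes clauses containing $l$, deletes $\bar l$ from clauses, and removes $y$ from the variable set. A variable $x\in V(\mathbf F)$ is frozen if all satisfying assignments of $\mathbf F$ agree on $x$, non-frozen otherwise. $\mathrm{SL}(\mathbf F)$ is the set of literals $l$ over $V(\mathbf F)$ with $\mathbf F^{[l]}$ satisfiable. Random process AssignSatisfiableLiterals$(\mathbf F)$ (for satisfiable $\mathbf F$): start with the empty assignment $\alpha'$; while $V(\mathbf F)\ne\emptyset$, choose $l$ uniformly at random from $\mathrm{SL}(\mathbf F)$, add $l$ to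 $\alpha'$ and set $\mathbf F\leftarrow\mathbf F^{[l]}$; output $\alpha'$. For an assignment $\alpha$ on a set $W\supseteq V(\mathbf F)$, $p(\mathbf F,\alpha)$ is the probability that this process outputs the restriction of $\alpha$ to $V(\mathbf F)$. $s$-implication, PPSZ, guessed: a literal $l$ is $s$-implied by $\mathbf F$ if some $G\subseteq F$ with $|G|\le s$ has all its satisfying assignments on $V$ satisfy $l$. $\mathrm{PPSZ}(\mathbf F,\beta,\pi,s)$ ($\beta$ an assignment, $\pi$ a permutation of $V(\mathbf F)$) processes variables $x$ in order $\pi$: first, while the current formula has an $s$-implied literal, restrict to it; then if $x$ is still a variable, restrict by $x\mapsto\beta(x)$ and call $x$ guessed. $p_{\mathrm{guessed}}(\mathbf F,x,\alpha,s)$ is the probability over uniform $\pi$ that $x$ is guessed in $\mathrm{PPSZ}(\mathbf F,\alpha,\pi,s)$ ($\alpha$ restricted to $V(\mathbf F)$ if defined on a superset; $0$ if $x\notin V(\mathbf F)$). Cost: fix an integer $s\ge0$ and let $S_k:=\int_0^1\frac{t^{1/(k-1)}-t}{1-t}\,dt$. Let $S$ be a real number with $S\ge S_k$ such that $p_{\mathrm{guessed}}(\mathbf F,x,\alpha,s)\le S$ for every satisfiable $(\le k)$-CNF $\mathbf F$, every frozen $x$ of $\mathbf F$ and every $\alpha\in\mathrm{sat}(\mathbf F)$. For a satisfiable $(\le k)$-CNF $\mathbf F$: $c(\mathbf F,x)=0$ if $x\notin V(\mathbf F)$; $c(\mathbf F,x)=S$ if $x$ is non-frozen; $c(\mathbf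 F,x)=\sum_{\alpha\in\mathrm{sat}(\mathbf F)}p(\mathbf F,\alpha)\,p_{\mathrm{guessed}}(\mathbf F,x,\alpha,s)$ if $x$ is frozen; and $c(\mathbf F):=\sum_{x\in V(\mathbf F)}c(\mathbf F,x)$.
   Formalization: The cost parameter S ranges over the rationals rather than the reals. -}

module Defs where

open import Data.Nat as ℕ using (ℕ; zero; suc; _≡ᵇ_)
open import Data.Bool using (Bool; true; false; not; _∧_; _∨_; if_then_else_; T)
open import Data.List using (List; []; _∷_; [_]; map; filterᵇ; concatMap; length; _++_; foldr)
open import Data.Bool.ListAction using (any; all)
open import Data.List.Relation.Unary.All using (All)
open import Data.List.Relation.Unary.Unique.Propositional using (Unique)
open import Data.List.Membership.Propositional using (_∈_)
open import Data.Maybe using (Maybe; just; nothing)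
open import Data.Product using (Σ; _×_)
open import Data.Integer using (+_)
open import Data.Rational using (ℚ; 0ℚ; 1ℚ; _+_; _*_; _/_)
open import Relation.Binary.PropositionalEquality using (_≡_)

record Lit : Set where
  constructor lit
  field
    var  : ℕ
    sign : Bool   -- lit x true = x , lit x false = x̄
open Lit public

Clause : Set
Clause = List Lit

record CNF : Set where
  constructor cnf
  field
    clauses : List Clause
    vars    : List ℕ
open CNF public

WF : CNF → Set
WF F = Unique (vars F) ×
       All (λ C → Unique (map var C) × All (λ l → var l ∈ vars F) C) (clauses F)

IsKCNF : ℕ → CNF → Set
IsKCNF k F = All (λ C → length C ℕ.≤ k) (clauses F)

-- Assignments: total maps ℕ → Bool; only their restriction to V(F) matters.

Assignment : Set
Assignment = ℕ → Bool

beq : Bool → Bool → Bool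
beq true  b = b
beq false b = not b

litTrue : Assignment → Lit → Bool
litTrue α (lit x b) = beq (α x) b

LitIn : Lit → Assignment → Set
LitIn l α = T (litTrue α l)

clauseTrue : Assignment → Clause → Bool
clauseTrue α C = any (litTrue α) C

satB : CNF → Assignment → Bool
satB F α = all (clauseTrue α) (clauses F)

Sat : CNF → Assignment → Set
Sat F α = T (satB F α)

Satisfiable : CNF → Set
Satisfiable F = Σ Assignment (λ α → Sat F α)

Frozen : CNF → ℕ → Set
Frozen F x = (x ∈ vars F) × (∀ α β → Sat F α → Sat F β → α x ≡ β x)

neg : Lit → Lit
neg (lit x b) = lit x (not b)

litEq : Lit → Lit → Bool
litEq (lit x b) (lit y c) = (x ≡ᵇ y) ∧ beq b c

memLit : Lit → Clause → Bool
memLit l C = any (litEq l) C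

memℕ : ℕ → List ℕ → Bool
memℕ x xs = any (x ≡ᵇ_) xs

restrict : Lit → CNF → CNF
restrict l F =
  cnf (map (filterᵇ (λ m → not (litEq m (neg l))))
           (filterᵇ (λ C → not (memLit l C)) (clauses F)))
      (filterᵇ (λ y → not (y ≡ᵇ var l)) (vars F))

update : ℕ → Bool → Assignment → Assignment
update v b f y = if y ≡ᵇ v then b else f y

allAssign : List ℕ → List Assignment
allAssign []       = [ (λ _ → false) ]
allAssign (v ∷ vs) = concatMap (λ f → update v false f ∷ update v true f ∷ []) (allAssign vs)

satList : CNF → List Assignment
satList F = filterᵇ (satB F) (allAssign (vars F))

satisfiableB : CNF → Bool
satisfiableB F = any (satB F) (allAssign (vars F))

frozenB : CNF → ℕ → Bool
frozenB F x = memℕ x (vars F) ∧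
  all (λ α → all (λ β → beq (α x) (β x)) (satList F)) (satList F)

litsOver : List ℕ → List Lit
litsOver vs = concatMap (λ x → lit x false ∷ lit x true ∷ []) vs

SL : CNF → List Lit
SL F = filterᵇ (λ l → satisfiableB (restrict l F)) (litsOver (vars F))

sumℚ : List ℚ → ℚ
sumℚ = foldr _+_ 0ℚ

ratio : ℕ → ℕ → ℚ
ratio a zero    = 0ℚ
ratio a (suc m) = + a / suc m

-- p(F, α): probability that AssignSatisfiableLiterals(F) outputs α|V(F).
-- Recursive description of the process (fuel = n(F)).

pAux : ℕ → CNF → Assignment → ℚ
pAux fuel F α with vars F
... | [] = 1ℚ
... | _ ∷ _ with fuel
...   | zero = 0ℚ
...   | suc n = sumℚ (map (λ l → if litTrue α l
                                    then ratio 1 (length (SL F)) * pAux n (restrict l F) α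
                                    else 0ℚ) (SL F))

p : CNF → Assignment → ℚ
p F α = pAux (length (vars F)) F α

subsetsUpTo : {A : Set} → ℕ → List A → List (List A)
subsetsUpTo s       []       = [ [] ]
subsetsUpTo zero    (x ∷ xs) = [ [] ]
subsetsUpTo (suc s) (x ∷ xs) = map (x ∷_) (subsetsUpTo s xs) ++ subsetsUpTo (suc s) xs

impliesB : List Clause → List ℕ → Lit → Bool
impliesB G vs l = all (λ α → not (all (clauseTrue α) G) ∨ litTrue α l) (allAssign vs)

sImpliedB : ℕ → CNF → Lit → Bool
sImpliedB s F l = any (λ G → impliesB G (vars F) l) (subsetsUpTo s (clauses F))

findFirst : (Lit → Bool) → List Lit → Maybe Lit
findFirst P []      = nothing
findFirst P (l ∷ ls) = if P l then just l else findFirst P ls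

closure : ℕ → ℕ → CNF → CNF
closure s zero    F = F
closure s (suc n) F with findFirst (sImpliedB s F) (litsOver (vars F))
... | nothing = F
... | just l  = closure s n (restrict l F)

-- is x guessed when PPSZ(F, β, π, s) processes the list π?
guessedB : ℕ → Assignment → ℕ → CNF → List ℕ → Bool
guessedB s β x F []      = false
guessedB s β x F (y ∷ π) with closure s (length (vars F)) F
... | F' = if memℕ y (vars F')
             then (if y ≡ᵇ x then true else guessedB s β x (restrict (lit y (β y)) F') π)
             else guessedB s β x F' π

insertions : {A : Set} → A → List A → List (List A)
insertions x []       = [ x ∷ [] ]
insertions x (y ∷ ys) = (x ∷ y ∷ ys) ∷ map (y ∷_) (insertions x ys)

perms : {A : Set} → List A → List (List A)
perms []       = [ [] ]
perms (x ∷ xs) = concatMap (insertions x) (perms xs)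

countTrue : List Bool → ℕ
countTrue []           = 0
countTrue (true ∷ bs)  = suc (countTrue bs)
countTrue (false ∷ bs) = countTrue bs

pGuessed : ℕ → CNF → ℕ → Assignment → ℚ
pGuessed s F x α =
  if memℕ x (vars F)
    then ratio (countTrue (map (guessedB s α x F) (perms (vars F)))) (length (perms (vars F)))
    else 0ℚ

costVar : ℚ → ℕ → CNF → ℕ → ℚ
costVar S s F x =
  if memℕ x (vars F)
    then (if frozenB F x
            then sumℚ (map (λ α → p F α * pGuessed s F x α) (satList F))
            else S)
    else 0ℚ

cost : ℚ → ℕ → CNF → ℚ
cost S s F = sumℚ (map (costVar S s F) (vars F))

-- For α ∈ sat(F) the process picks, with probability 1/|SL(F)|, one of the literals α(x), so
-- |SL(F)| p(F,α) = Σ_{x ∈ V} p(F^[α(x)],α). Splitting off x = v and comparing with the same identity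
-- for F^[α(v)], whose children are the F^[α(x)]^[α(v)], gives p(F,α) ≤ p(F^[α(v)],α) by induction on
-- n(F), because |SL(F^[α(v)])| < |SL(F)|. If v is frozen, SL loses exactly the literal α(v), and the
-- same computation gives equality.
--
-- For the cost, a frozen variable y ≠ v of F stays frozen in F^[α(v)] and its satisfying assignments
-- extend uniquely to those of F, with the same value of p. PPSZ on F with a permutation π guesses x
-- whenever PPSZ on F^[α(v)] with π minus v does: every formula of the first run is F with the
-- variables outside some set pinned to α, s-implications survive pinning further variables to α, so
-- the first run never fixes a variable that the second run still has. Summing over the |V| insertion
-- points of v into each permutation of V ∖ v shows that p_guessed can only decrease, and the
-- non-negative cost of v itself disappears.

module Submission where

open import Defs
open import Algebra.Bundles using (CommutativeMonoid)
import Algebra.Properties.CommutativeSemigroup as CommutativeSemigroupₚ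
open import Data.Bool using (Bool; true; false; not; _∧_; _∨_; if_then_else_; T)
import Data.Bool.Properties as Boolₚ
open import Data.Bool.ListAction using (any; all)
open import Data.Empty using (⊥-elim)
open import Data.Integer as ℤ using (+≤+)
import Data.Integer.Properties as ℤₚ
open import Data.List using (List; []; _∷_; map; filterᵇ; concatMap; length; _++_)
import Data.List.Properties as Listₚ
open import Data.List.Membership.Propositional using (_∈_; find; lose)
open import Data.List.Membership.Propositional.Properties
  using (∈-map⁺; ∈-map⁻; ∈-++⁺ˡ; ∈-++⁺ʳ; ∈-++⁻; ∈-filter⁺; ∈-filter⁻; ∈-concatMap⁺; ∈-concatMap⁻)
open import Data.List.Relation.Unary.Any as Any using (here; there)
import Data.List.Relation.Unary.Any.Properties as Anyₚ
open import Data.List.Relation.Unary.All as All using (All; []; _∷_)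
import Data.List.Relation.Unary.All.Properties as Allₚ
open import Data.List.Relation.Unary.AllPairs using ([]; _∷_)
open import Data.List.Relation.Unary.Unique.Propositional using (Unique)
import Data.List.Relation.Unary.Unique.Propositional.Properties as Uniqueₚ
open import Data.List.Relation.Binary.Sublist.Propositional as Sublist using (_⊆_; []; _∷_; _∷ʳ_)
import Data.List.Relation.Binary.Sublist.Propositional.Properties as Sublistₚ
open import Data.List.Relation.Binary.Permutation.Propositional as Perm
  using (_↭_; prep; swap; ↭-sym; ↭-trans; ↭-reflexive)
import Data.List.Relation.Binary.Permutation.Propositional.Properties as Permₚ
open import Data.Maybe using (just; nothing)
open import Data.Nat as ℕ using (ℕ; zero; suc; _≡ᵇ_)
import Data.Nat.Properties as ℕₚ
open import Data.List.Membership.DecPropositional ℕₚ._≟_ using (_∈?_)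
open import Data.Product using (∃; _×_; _,_; proj₁; proj₂)
open import Data.Rational as ℚ using (ℚ; 0ℚ; 1ℚ; _+_; _*_; _≤_; toℚᵘ)
import Data.Rational.Properties as ℚₚ
open import Data.Rational.Unnormalised as ℚᵘ using (mkℚᵘ; *≡*; *≤*)
import Data.Rational.Unnormalised.Properties as ℚᵘₚ
open import Data.Sum using (_⊎_; inj₁; inj₂)
open import Function using (_∘_)
open import Function.Bundles using (Equivalence)
open import Relation.Nullary using (¬_; Dec; yes; no; T?)
open import Relation.Binary.PropositionalEquality

T→≡ : ∀ {b} → T b → b ≡ true
T→≡ = Equivalence.to Boolₚ.T-≡

≡→T : ∀ {b} → b ≡ true → T b
≡→T = Equivalence.from Boolₚ.T-≡

≡ᵇ-refl : ∀ x → (x ≡ᵇ x) ≡ true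
≡ᵇ-refl x = T→≡ (ℕₚ.≡⇒≡ᵇ x x refl)

≡ᵇ-true : ∀ {x y} → (x ≡ᵇ y) ≡ true → x ≡ y
≡ᵇ-true {x} {y} e = ℕₚ.≡ᵇ⇒≡ x y (≡→T e)

≡ᵇ-false : ∀ {x y} → x ≢ y → (x ≡ᵇ y) ≡ false
≡ᵇ-false {x} {y} ne with x ≡ᵇ y in e
... | true = ⊥-elim (ne (≡ᵇ-true e))
... | false = refl

≡ᵇ-false⇒≢ : ∀ {x y} → (x ≡ᵇ y) ≡ false → x ≢ y
≡ᵇ-false⇒≢ {x} e refl with trans (sym (≡ᵇ-refl x)) e
... | ()

beq-refl : ∀ b → beq b b ≡ true
beq-refl true = refl
beq-refl false = refl

beq-true : ∀ {a b} → beq a b ≡ true → a ≡ b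
beq-true {true} {true} _ = refl
beq-true {false} {false} _ = refl

beq-not : ∀ a b → beq a (not b) ≡ not (beq a b)
beq-not true b = refl
beq-not false true = refl
beq-not false false = refl

not-true : ∀ {b} → not b ≡ true → b ≡ false
not-true {false} _ = refl

not-false : ∀ {b} → not b ≡ false → b ≡ true
not-false {true} _ = refl

∧-true : ∀ {a b} → a ∧ b ≡ true → (a ≡ true) × (b ≡ true)
∧-true {true} {true} _ = refl , refl

true≢false : true ≢ false
true≢false ()

not-≢-self : ∀ b → not b ≢ b
not-≢-self b e = Boolₚ.not-¬ refl (sym e)

Bool-ext : ∀ {a b : Bool} → (a ≡ true → b ≡ true) → (b ≡ true → a ≡ true) → a ≡ b
Bool-ext {true} f g = sym (f refl)
Bool-ext {false} {false} f g = refl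
Bool-ext {false} {true} f g = g refl

not-∨ : ∀ a b → not (a ∨ b) ≡ not a ∧ not b
not-∨ true b = refl
not-∨ false b = refl

sign-cases : ∀ (b c : Bool) → (c ≡ b) ⊎ (c ≡ not b)
sign-cases true true = inj₁ refl
sign-cases true false = inj₂ refl
sign-cases false true = inj₂ refl
sign-cases false false = inj₁ refl

∨-interchange : ∀ a b c d → (a ∨ b) ∨ (c ∨ d) ≡ (a ∨ c) ∨ (b ∨ d)
∨-interchange = CommutativeSemigroupₚ.interchange (CommutativeMonoid.commutativeSemigroup Boolₚ.∨-commutativeMonoid)

module _ {A : Set} (p : A → Bool) where

  ∈-filterᵇ⁻ : ∀ {x} xs → x ∈ filterᵇ p xs → (x ∈ xs) × (p x ≡ true)
  ∈-filterᵇ⁻ xs m = let x∈xs , px = ∈-filter⁻ (T? ∘ p) {xs = xs} m in x∈xs , T→≡ px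

  ∈-filterᵇ⁺ : ∀ {x} xs → x ∈ xs → p x ≡ true → x ∈ filterᵇ p xs
  ∈-filterᵇ⁺ xs m px = ∈-filter⁺ (T? ∘ p) m (≡→T px)

  filterᵇ-accept : ∀ {x} xs → p x ≡ true → filterᵇ p (x ∷ xs) ≡ x ∷ filterᵇ p xs
  filterᵇ-accept xs px = Listₚ.filter-accept (T? ∘ p) (≡→T px)

  filterᵇ-reject : ∀ {x} xs → p x ≡ false → filterᵇ p (x ∷ xs) ≡ filterᵇ p xs
  filterᵇ-reject xs px = Listₚ.filter-reject (T? ∘ p) (subst T px)

  filterᵇ-all : ∀ xs → (∀ {x} → x ∈ xs → p x ≡ true) → filterᵇ p xs ≡ xs
  filterᵇ-all xs h = Listₚ.filter-all (T? ∘ p) (All.tabulate (≡→T ∘ h))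

  length-filterᵇ-≤ : ∀ xs → length (filterᵇ p xs) ℕ.≤ length xs
  length-filterᵇ-≤ = Listₚ.length-filter (T? ∘ p)

  any⁻ : ∀ xs → any p xs ≡ true → ∃ λ x → (x ∈ xs) × (p x ≡ true)
  any⁻ xs e = let x , x∈xs , px = find (Anyₚ.any⁻ p xs (≡→T e)) in x , x∈xs , T→≡ px

  any⁺ : ∀ {x} xs → x ∈ xs → p x ≡ true → any p xs ≡ true
  any⁺ xs m px = T→≡ (Anyₚ.any⁺ p (lose m (≡→T px)))

  any-false : ∀ xs → (∀ {x} → x ∈ xs → p x ≡ false) → any p xs ≡ false
  any-false [] h = refl
  any-false (x ∷ xs) h rewrite h (here refl) = any-false xs (h ∘ there)

  all⁻ : ∀ xs → all p xs ≡ true → ∀ {x} → x ∈ xs → p x ≡ true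
  all⁻ xs e m = T→≡ (All.lookup (Allₚ.all⁺ p xs (≡→T e)) m)

  all⁺ : ∀ xs → (∀ {x} → x ∈ xs → p x ≡ true) → all p xs ≡ true
  all⁺ xs h = T→≡ (Allₚ.all⁻ p (All.tabulate (≡→T ∘ h)))

module _ {A : Set} where

  filterᵇ-cong : ∀ (p q : A → Bool) xs → (∀ {x} → x ∈ xs → p x ≡ q x) → filterᵇ p xs ≡ filterᵇ q xs
  filterᵇ-cong p q [] h = refl
  filterᵇ-cong p q (x ∷ xs) h with p x in px
  ... | true = trans (cong (x ∷_) (filterᵇ-cong p q xs (h ∘ there)))
                     (sym (filterᵇ-accept q xs (trans (sym (h (here refl))) px)))
  ... | false = trans (filterᵇ-cong p q xs (h ∘ there))
                      (sym (filterᵇ-reject q xs (trans (sym (h (here refl))) px)))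

  filterᵇ-filterᵇ : ∀ (p q : A → Bool) xs → filterᵇ q (filterᵇ p xs) ≡ filterᵇ (λ x → p x ∧ q x) xs
  filterᵇ-filterᵇ p q [] = refl
  filterᵇ-filterᵇ p q (x ∷ xs) with p x
  ... | false = filterᵇ-filterᵇ p q xs
  ... | true with q x
  ...   | true = cong (x ∷_) (filterᵇ-filterᵇ p q xs)
  ...   | false = filterᵇ-filterᵇ p q xs

  filterᵇ-comm : ∀ (p q : A → Bool) xs → filterᵇ p (filterᵇ q xs) ≡ filterᵇ q (filterᵇ p xs)
  filterᵇ-comm p q xs = begin
    filterᵇ p (filterᵇ q xs)        ≡⟨ filterᵇ-filterᵇ q p xs ⟩
    filterᵇ (λ x → q x ∧ p x) xs    ≡⟨ filterᵇ-cong _ _ xs (λ {x} _ → Boolₚ.∧-comm (q x) (p x)) ⟩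
    filterᵇ (λ x → p x ∧ q x) xs    ≡⟨ filterᵇ-filterᵇ p q xs ⟨
    filterᵇ q (filterᵇ p xs)        ∎
    where open ≡-Reasoning

  filterᵇ-nonEmpty : ∀ (q : A → Bool) L {x xs} → filterᵇ q L ≡ x ∷ xs → ∃ λ m → length L ≡ suc m
  filterᵇ-nonEmpty q [] ()
  filterᵇ-nonEmpty q (y ∷ L) _ = length L , refl

  any-cong : ∀ (f g : A → Bool) xs → (∀ {x} → x ∈ xs → f x ≡ g x) → any f xs ≡ any g xs
  any-cong f g [] h = refl
  any-cong f g (x ∷ xs) h = cong₂ _∨_ (h (here refl)) (any-cong f g xs (h ∘ there))

  any-∨ : ∀ (f g : A → Bool) xs → any (λ x → f x ∨ g x) xs ≡ any f xs ∨ any g xs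
  any-∨ f g [] = refl
  any-∨ f g (x ∷ xs) rewrite any-∨ f g xs = ∨-interchange (f x) (g x) (any f xs) (any g xs)

neq : ℕ → ℕ → Bool
neq v y = not (y ≡ᵇ v)

neq-≢ : ∀ {v y} → y ≢ v → neq v y ≡ true
neq-≢ y≢v = cong not (≡ᵇ-false y≢v)

neq-self : ∀ v → neq v v ≡ false
neq-self v = cong not (≡ᵇ-refl v)

filterᵇ-neq-head : ∀ {y : ℕ} {ys} → Unique (y ∷ ys) → filterᵇ (neq y) (y ∷ ys) ≡ ys
filterᵇ-neq-head {y} {ys} (y≢ ∷ _) =
  trans (filterᵇ-reject (neq y) {y} ys (neq-self y)) (filterᵇ-all (neq y) ys (λ z∈ → neq-≢ (≢-sym (All.lookup y≢ z∈))))

↭-extract : ∀ {v} V → v ∈ V → Unique V → V ↭ v ∷ filterᵇ (neq v) V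
↭-extract (y ∷ ys) (here refl) u = ↭-reflexive (cong (y ∷_) (sym (filterᵇ-neq-head u)))
↭-extract {v} (y ∷ ys) (there m) (y≢ ∷ u) rewrite neq-≢ (All.lookup y≢ m) =
  ↭-trans (prep y (↭-extract ys m u)) (swap y v Perm.refl)

length-vars-extract : ∀ {v} vs → v ∈ vs → Unique vs → suc (length (filterᵇ (neq v) vs)) ≡ length vs
length-vars-extract vs v∈ u = sym (Permₚ.↭-length (↭-extract vs v∈ u))

concatMap-↭ : ∀ {A B : Set} (f : A → List B) {xs ys} → xs ↭ ys → concatMap f xs ↭ concatMap f ys
concatMap-↭ f Perm.refl = Perm.refl
concatMap-↭ f (prep x p) = Permₚ.++⁺ˡ (f x) (concatMap-↭ f p)
concatMap-↭ f (swap x y p) = ↭-trans (Permₚ.shifts (f x) (f y)) (Permₚ.++⁺ˡ (f y) (Permₚ.++⁺ˡ (f x) (concatMap-↭ f p)))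
concatMap-↭ f (Perm.trans p q) = Perm.trans (concatMap-↭ f p) (concatMap-↭ f q)

litEq⇒≡ : ∀ {l m} → litEq l m ≡ true → l ≡ m
litEq⇒≡ {lit x b} {lit y c} e with ∧-true {x ≡ᵇ y} e
... | e1 , e2 rewrite ≡ᵇ-true {x} {y} e1 | beq-true {b} {c} e2 = refl

litEq-refl : ∀ l → litEq l l ≡ true
litEq-refl (lit x b) rewrite ≡ᵇ-refl x = beq-refl b

litEq-≢var : ∀ {l m} → var l ≢ var m → litEq l m ≡ false
litEq-≢var {lit x b} {lit y c} ne rewrite ≡ᵇ-false ne = refl

memLit⇒∈ : ∀ {l} C → memLit l C ≡ true → l ∈ C
memLit⇒∈ {l} C e with any⁻ (litEq l) C e
... | m , m∈C , l≡m rewrite litEq⇒≡ {l} {m} l≡m = m∈C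

∈⇒memLit : ∀ {l} C → l ∈ C → memLit l C ≡ true
∈⇒memLit {l} C m = any⁺ (litEq l) C m (litEq-refl l)

litTrue-neg : ∀ α l → litTrue α (neg l) ≡ not (litTrue α l)
litTrue-neg α (lit x b) = beq-not (α x) b

var-neg : ∀ m → var (neg m) ≡ var m
var-neg (lit x b) = refl

same-var-lit : ∀ l m → var m ≡ var l → (m ≡ l) ⊎ (m ≡ neg l)
same-var-lit (lit x b) (lit .x c) refl with sign-cases b c
... | inj₁ refl = inj₁ refl
... | inj₂ refl = inj₂ refl

αlit : Assignment → ℕ → Lit
αlit α x = lit x (α x)

αlit-true : ∀ α x → litTrue α (αlit α x) ≡ true
αlit-true α x = beq-refl (α x)

litTrue⇒αlit : ∀ α m → litTrue α m ≡ true → m ≡ αlit α (var m)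
litTrue⇒αlit α (lit x b) e = cong (lit x) (sym (beq-true e))

update-≡ : ∀ v b f → update v b f v ≡ b
update-≡ v b f rewrite ≡ᵇ-refl v = refl

update-≢ : ∀ {v y} b f → y ≢ v → update v b f y ≡ f y
update-≢ {v} {y} b f ne rewrite ≡ᵇ-false ne = refl

litTrue-update : ∀ β l → litTrue (update (var l) (sign l) β) l ≡ true
litTrue-update β (lit x b) rewrite update-≡ x b β = beq-refl b

Agree : List ℕ → Assignment → Assignment → Set
Agree vs a b = ∀ {y} → y ∈ vs → a y ≡ b y

Agree-⊆ : ∀ {vs ws a b} → (∀ {y} → y ∈ ws → y ∈ vs) → Agree vs a b → Agree ws a b
Agree-⊆ ws⊆vs ag m = ag (ws⊆vs m)

allAssign-complete : ∀ vs (a : Assignment) → ∃ λ b → (b ∈ allAssign vs) × Agree vs b a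
allAssign-complete [] a = (λ _ → false) , here refl , λ ()
allAssign-complete (v ∷ vs) a with allAssign-complete vs a
... | f , f∈ , ag = update v (a v) f , mem , ag′
  where
  mem : update v (a v) f ∈ allAssign (v ∷ vs)
  mem with a v
  ... | false = ∈-concatMap⁺ _ (Any.map (λ { refl → here refl }) f∈)
  ... | true = ∈-concatMap⁺ _ (Any.map (λ { refl → there (here refl) }) f∈)
  ag′ : Agree (v ∷ vs) (update v (a v) f) a
  ag′ {y} m with y ≡ᵇ v in e
  ... | true = cong a (sym (≡ᵇ-true e))
  ag′ {y} (here refl) | false = ⊥-elim (≡ᵇ-false⇒≢ {y} {y} e refl)
  ag′ {y} (there m) | false = ag m

WellScoped : CNF → Set
WellScoped F = All (All (λ l → var l ∈ vars F)) (clauses F)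

WF⇒WellScoped : ∀ {F} → WF F → WellScoped F
WF⇒WellScoped (_ , h) = All.map proj₂ h

litTrue-Agree : ∀ {vs a b} l → var l ∈ vs → Agree vs a b → litTrue a l ≡ litTrue b l
litTrue-Agree (lit x c) m ag = cong (λ t → beq t c) (ag m)

clauseTrue-Agree : ∀ {vs a b} C → All (λ l → var l ∈ vs) C → Agree vs a b → clauseTrue a C ≡ clauseTrue b C
clauseTrue-Agree [] [] ag = refl
clauseTrue-Agree (l ∷ C) (m ∷ ms) ag = cong₂ _∨_ (litTrue-Agree l m ag) (clauseTrue-Agree C ms ag)

all-clauseTrue-Agree : ∀ {vs a b} G → All (All (λ l → var l ∈ vs)) G → Agree vs a b →
                       all (clauseTrue a) G ≡ all (clauseTrue b) G
all-clauseTrue-Agree [] [] ag = refl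
all-clauseTrue-Agree (C ∷ G) (m ∷ ms) ag = cong₂ _∧_ (clauseTrue-Agree C m ag) (all-clauseTrue-Agree G ms ag)

satB-Agree : ∀ F {a b} → WellScoped F → Agree (vars F) a b → satB F a ≡ satB F b
satB-Agree F ws ag = all-clauseTrue-Agree (clauses F) ws ag

satB⁻ : ∀ F a → satB F a ≡ true → ∀ {C} → C ∈ clauses F → clauseTrue a C ≡ true
satB⁻ F a = all⁻ (clauseTrue a) (clauses F)

satB⁺ : ∀ F a → (∀ {C} → C ∈ clauses F → clauseTrue a C ≡ true) → satB F a ≡ true
satB⁺ F a = all⁺ (clauseTrue a) (clauses F)

satisfiableB-sound : ∀ F → satisfiableB F ≡ true → Satisfiable F
satisfiableB-sound F e with any⁻ (satB F) (allAssign (vars F)) e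
... | a , _ , s = a , ≡→T s

satisfiableB-complete : ∀ F → WellScoped F → Satisfiable F → satisfiableB F ≡ true
satisfiableB-complete F ws (a , s) with allAssign-complete (vars F) a
... | b , b∈ , ag = any⁺ (satB F) (allAssign (vars F)) b∈ (trans (satB-Agree F ws ag) (T→≡ s))


dropNeg : Lit → Clause → Clause
dropNeg l = filterᵇ (λ m → not (litEq m (neg l)))

avoids : Lit → Clause → Bool
avoids l C = not (memLit l C)

clauseTrue-dropNeg : ∀ α l C → litTrue α l ≡ true → clauseTrue α C ≡ true → clauseTrue α (dropNeg l C) ≡ true
clauseTrue-dropNeg α l C tl tc with any⁻ (litTrue α) C tc
... | m , m∈C , tm = any⁺ (litTrue α) (dropNeg l C) (∈-filterᵇ⁺ _ C m∈C m≢l̄) tm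
  where
  m≢l̄ : not (litEq m (neg l)) ≡ true
  m≢l̄ with litEq m (neg l) in e
  ... | false = refl
  ... | true with trans (sym tm) (trans (cong (litTrue α) (litEq⇒≡ e)) (trans (litTrue-neg α l) (cong not tl)))
  ... | ()

satB-restrict : ∀ F α l → satB F α ≡ true → litTrue α l ≡ true → satB (restrict l F) α ≡ true
satB-restrict F α l s tl = satB⁺ (restrict l F) α clausewise
  where
  clausewise : ∀ {C} → C ∈ clauses (restrict l F) → clauseTrue α C ≡ true
  clausewise m with ∈-map⁻ (dropNeg l) m
  ... | C , C∈ , refl = clauseTrue-dropNeg α l C tl (satB⁻ F α s (proj₁ (∈-filterᵇ⁻ _ (clauses F) C∈)))

clauseTrue-update : ∀ β l C → memLit l C ≡ false → clauseTrue β (dropNeg l C) ≡ true →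
                    clauseTrue (update (var l) (sign l) β) C ≡ true
clauseTrue-update β l C l∉C tc with any⁻ (litTrue β) (dropNeg l C) tc
... | m , m∈ , tm with ∈-filterᵇ⁻ _ C m∈
... | m∈C , m≢l̄ = any⁺ (litTrue (update (var l) (sign l) β)) C m∈C (unchanged l m m∈C l∉C m≢l̄ tm)
  where
  unchanged : ∀ l m → m ∈ C → memLit l C ≡ false → not (litEq m (neg l)) ≡ true → litTrue β m ≡ true →
              litTrue (update (var l) (sign l) β) m ≡ true
  unchanged (lit v b) (lit y c) m∈C l∉C m≢l̄ tm with y ℕₚ.≟ v
  ... | no y≢v rewrite update-≢ {v} {y} b β y≢v = tm
  ... | yes refl with sign-cases b c
  ... | inj₁ refl with trans (sym (∈⇒memLit C m∈C)) l∉C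
  ... | ()
  unchanged (lit v b) (lit y c) m∈C l∉C m≢l̄ tm | yes refl | inj₂ refl rewrite ≡ᵇ-refl y | beq-refl (not b) with m≢l̄
  ... | ()

satB-update : ∀ F β l → satB (restrict l F) β ≡ true → satB F (update (var l) (sign l) β) ≡ true
satB-update F β l s = satB⁺ F (update (var l) (sign l) β) clausewise
  where
  clausewise : ∀ {C} → C ∈ clauses F → clauseTrue (update (var l) (sign l) β) C ≡ true
  clausewise {C} C∈ with memLit l C in l∈?C
  ... | false = clauseTrue-update β l C l∈?C
                  (satB⁻ (restrict l F) β s (∈-map⁺ (dropNeg l) (∈-filterᵇ⁺ (avoids l) (clauses F) C∈ (cong not l∈?C))))
  ... | true = any⁺ (litTrue (update (var l) (sign l) β)) C (memLit⇒∈ {l} C l∈?C) (litTrue-update β l)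

∈-vars-restrict : ∀ {x} l F → x ∈ vars F → x ≢ var l → x ∈ vars (restrict l F)
∈-vars-restrict l F m x≢ = ∈-filterᵇ⁺ (neq (var l)) (vars F) m (neq-≢ x≢)

vars-restrict-∈ : ∀ {x} l F → x ∈ vars (restrict l F) → (x ∈ vars F) × (x ≢ var l)
vars-restrict-∈ l F m with ∈-filterᵇ⁻ (neq (var l)) (vars F) m
... | x∈ , e = x∈ , ≡ᵇ-false⇒≢ (not-true e)

Unique-map-filterᵇ : ∀ {A B : Set} (f : A → B) (p : A → Bool) xs → Unique (map f xs) → Unique (map f (filterᵇ p xs))
Unique-map-filterᵇ f p [] u = u
Unique-map-filterᵇ f p (x ∷ xs) (fx≢ ∷ u) with p x
... | true = All.tabulate (All.lookup fx≢ ∘ ⊆-map) ∷ Unique-map-filterᵇ f p xs u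
  where
  ⊆-map : ∀ {y} → y ∈ map f (filterᵇ p xs) → y ∈ map f xs
  ⊆-map m with ∈-map⁻ f m
  ... | z , z∈ , refl = ∈-map⁺ f (proj₁ (∈-filterᵇ⁻ p xs z∈))
... | false = Unique-map-filterᵇ f p xs u

∈-clauses-restrict⁻ : ∀ l F C′ → C′ ∈ clauses (restrict l F) →
  ∃ λ C → (C ∈ clauses F) × (avoids l C ≡ true) × (C′ ≡ dropNeg l C)
∈-clauses-restrict⁻ l F C′ m with ∈-map⁻ (dropNeg l) m
... | C , C∈ , refl with ∈-filterᵇ⁻ (avoids l) (clauses F) C∈
... | C∈F , l∉C = C , C∈F , l∉C , refl

dropNeg-var-≢ : ∀ l C m → m ∈ dropNeg l C → avoids l C ≡ true → var m ≢ var l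
dropNeg-var-≢ l C m m∈ l∉C same with ∈-filterᵇ⁻ _ C m∈ | same-var-lit l m same
... | m∈C , _ | inj₁ refl with trans (sym (cong not (∈⇒memLit C m∈C))) l∉C
... | ()
dropNeg-var-≢ l C m m∈ l∉C same | _ , m≢l̄ | inj₂ refl rewrite litEq-refl (neg l) with m≢l̄
... | ()

restrict-WellScoped : ∀ l F → WellScoped F → WellScoped (restrict l F)
restrict-WellScoped l F ws = All.tabulate clausewise
  where
  clausewise : ∀ {C′} → C′ ∈ clauses (restrict l F) → All (λ m → var m ∈ vars (restrict l F)) C′
  clausewise {C′} m with ∈-clauses-restrict⁻ l F C′ m
  ... | C , C∈ , l∉C , refl = All.tabulate λ {m′} m′∈ →
        ∈-vars-restrict l F (All.lookup (All.lookup ws C∈) (proj₁ (∈-filterᵇ⁻ _ C m′∈))) (dropNeg-var-≢ l C m′ m′∈ l∉C)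

restrict-WF : ∀ l F → WF F → WF (restrict l F)
restrict-WF l F wf@(u , h) = Uniqueₚ.filter⁺ _ u , All.tabulate clausewise
  where
  clausewise : ∀ {C′} → C′ ∈ clauses (restrict l F) → Unique (map var C′) × All (λ m → var m ∈ vars (restrict l F)) C′
  clausewise {C′} m with ∈-clauses-restrict⁻ l F C′ m
  ... | C , C∈ , _ , refl = Unique-map-filterᵇ var _ C (proj₁ (All.lookup h C∈)) ,
                            All.lookup (restrict-WellScoped l F (WF⇒WellScoped wf)) m

memLit-dropNeg : ∀ l m C → var l ≢ var m → memLit l (dropNeg m C) ≡ memLit l C
memLit-dropNeg l m [] ne = refl
memLit-dropNeg l m (c ∷ C) ne with litEq c (neg m) in c≡m̄
... | true rewrite litEq⇒≡ {c} {neg m} c≡m̄ | litEq-≢var {l} {neg m} (λ q → ne (trans q (var-neg m))) =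
  memLit-dropNeg l m C ne
... | false = cong (litEq l c ∨_) (memLit-dropNeg l m C ne)

map-filterᵇ-comm : ∀ {X : Set} (f f′ : X → X) (g g′ : X → Bool) →
  (∀ C → g (f′ C) ≡ g C) → (∀ C → g′ (f C) ≡ g′ C) → (∀ C → f (f′ C) ≡ f′ (f C)) →
  ∀ cs → map f (filterᵇ g (map f′ (filterᵇ g′ cs))) ≡ map f′ (filterᵇ g′ (map f (filterᵇ g cs)))
map-filterᵇ-comm f f′ g g′ hg hg′ hf [] = refl
map-filterᵇ-comm f f′ g g′ hg hg′ hf (C ∷ cs) = by-tests (g′ C) refl (g C) refl
  where
  ih : map f (filterᵇ g (map f′ (filterᵇ g′ cs))) ≡ map f′ (filterᵇ g′ (map f (filterᵇ g cs)))
  ih = map-filterᵇ-comm f f′ g g′ hg hg′ hf cs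
  by-tests : ∀ b → g′ C ≡ b → ∀ c → g C ≡ c →
       map f (filterᵇ g (map f′ (filterᵇ g′ (C ∷ cs)))) ≡ map f′ (filterᵇ g′ (map f (filterᵇ g (C ∷ cs))))
  by-tests true e1 true e2 = trans (cong (λ z → map f (filterᵇ g (map f′ z))) (filterᵇ-accept g′ cs e1))
    (trans (cong (map f) (filterᵇ-accept g _ (trans (hg C) e2)))
    (trans (cong₂ _∷_ (hf C) ih)
    (sym (trans (cong (λ z → map f′ (filterᵇ g′ (map f z))) (filterᵇ-accept g cs e2))
         (cong (map f′) (filterᵇ-accept g′ _ (trans (hg′ C) e1)))))))
  by-tests true e1 false e2 = trans (cong (λ z → map f (filterᵇ g (map f′ z))) (filterᵇ-accept g′ cs e1))
    (trans (cong (map f) (filterᵇ-reject g _ (trans (hg C) e2)))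
    (trans ih (sym (cong (λ z → map f′ (filterᵇ g′ (map f z))) (filterᵇ-reject g cs e2)))))
  by-tests false e1 true e2 = trans (cong (λ z → map f (filterᵇ g (map f′ z))) (filterᵇ-reject g′ cs e1))
    (trans ih
    (sym (trans (cong (λ z → map f′ (filterᵇ g′ (map f z))) (filterᵇ-accept g cs e2))
         (cong (map f′) (filterᵇ-reject g′ _ (trans (hg′ C) e1))))))
  by-tests false e1 false e2 = trans (cong (λ z → map f (filterᵇ g (map f′ z))) (filterᵇ-reject g′ cs e1))
    (trans ih (sym (cong (λ z → map f′ (filterᵇ g′ (map f z))) (filterᵇ-reject g cs e2))))

restrict-comm : ∀ l m F → var l ≢ var m → restrict l (restrict m F) ≡ restrict m (restrict l F)
restrict-comm l m F ne = cong₂ cnf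
  (map-filterᵇ-comm (dropNeg l) (dropNeg m) (avoids l) (avoids m)
     (λ C → cong not (memLit-dropNeg l m C ne)) (λ C → cong not (memLit-dropNeg m l C (ne ∘ sym)))
     (λ C → filterᵇ-comm _ _ C) (clauses F))
  (filterᵇ-comm _ _ (vars F))

private
  toℚᵘ-ratio : ∀ a d → toℚᵘ (ratio a (suc d)) ℚᵘ.≃ mkℚᵘ (ℤ.+ a) d
  toℚᵘ-ratio a d = ℚₚ.toℚᵘ-fromℚᵘ (mkℚᵘ (ℤ.+ a) d)

ratio-≤ : ∀ a d b e → a ℕ.* suc e ℕ.≤ b ℕ.* suc d → ratio a (suc d) ≤ ratio b (suc e)
ratio-≤ a d b e h = ℚₚ.toℚᵘ-cancel-≤
  (ℚᵘₚ.≤-respˡ-≃ (ℚᵘₚ.≃-sym (toℚᵘ-ratio a d)) (ℚᵘₚ.≤-respʳ-≃ (ℚᵘₚ.≃-sym (toℚᵘ-ratio b e)) (*≤* h′)))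
  where
  h′ : (ℤ.+ a) ℤ.* (ℤ.+ suc e) ℤ.≤ (ℤ.+ b) ℤ.* (ℤ.+ suc d)
  h′ = subst₂ ℤ._≤_ (ℤₚ.pos-* a (suc e)) (ℤₚ.pos-* b (suc d)) (+≤+ h)

ratio-≡ : ∀ a d b e → a ℕ.* suc e ≡ b ℕ.* suc d → ratio a (suc d) ≡ ratio b (suc e)
ratio-≡ a d b e h = ℚₚ.toℚᵘ-injective
  (ℚᵘₚ.≃-trans (toℚᵘ-ratio a d) (ℚᵘₚ.≃-trans (*≡* h′) (ℚᵘₚ.≃-sym (toℚᵘ-ratio b e))))
  where
  h′ : (ℤ.+ a) ℤ.* (ℤ.+ suc e) ≡ (ℤ.+ b) ℤ.* (ℤ.+ suc d)
  h′ = trans (sym (ℤₚ.pos-* a (suc e))) (trans (cong ℤ.+_ h) (ℤₚ.pos-* b (suc d)))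

ratio-* : ∀ a d b e → ratio a (suc d) * ratio b (suc e) ≡ ratio (a ℕ.* b) (suc d ℕ.* suc e)
ratio-* a d b e = ℚₚ.toℚᵘ-injective
  (ℚᵘₚ.≃-trans (ℚₚ.toℚᵘ-homo-* (ratio a (suc d)) (ratio b (suc e)))
  (ℚᵘₚ.≃-trans (ℚᵘₚ.*-cong (toℚᵘ-ratio a d) (toℚᵘ-ratio b e))
  (ℚᵘₚ.≃-trans (*≡* (cong (ℤ._* (ℤ.+ suc (e ℕ.+ d ℕ.* suc e))) (sym (ℤₚ.pos-* a b))))
    (ℚᵘₚ.≃-sym (toℚᵘ-ratio (a ℕ.* b) (e ℕ.+ d ℕ.* suc e))))))

ratio-+ : ∀ a d b e → ratio a (suc d) + ratio b (suc e) ≡ ratio (a ℕ.* suc e ℕ.+ b ℕ.* suc d) (suc d ℕ.* suc e)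
ratio-+ a d b e = ℚₚ.toℚᵘ-injective
  (ℚᵘₚ.≃-trans (ℚₚ.toℚᵘ-homo-+ (ratio a (suc d)) (ratio b (suc e)))
  (ℚᵘₚ.≃-trans (ℚᵘₚ.+-cong (toℚᵘ-ratio a d) (toℚᵘ-ratio b e))
  (ℚᵘₚ.≃-trans (*≡* (cong (ℤ._* (ℤ.+ suc (e ℕ.+ d ℕ.* suc e))) numerator))
    (ℚᵘₚ.≃-sym (toℚᵘ-ratio (a ℕ.* suc e ℕ.+ b ℕ.* suc d) (e ℕ.+ d ℕ.* suc e))))))
  where
  numerator : (ℤ.+ a) ℤ.* (ℤ.+ suc e) ℤ.+ (ℤ.+ b) ℤ.* (ℤ.+ suc d) ≡ ℤ.+ (a ℕ.* suc e ℕ.+ b ℕ.* suc d)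
  numerator = trans (cong₂ ℤ._+_ (sym (ℤₚ.pos-* a (suc e))) (sym (ℤₚ.pos-* b (suc d))))
                    (sym (ℤₚ.pos-+ (a ℕ.* suc e) (b ℕ.* suc d)))

ratio-nonNeg : ∀ a b → 0ℚ ≤ ratio a b
ratio-nonNeg a zero = ℚₚ.≤-refl
ratio-nonNeg a (suc d) = ratio-≤ 0 0 a d ℕ.z≤n

fromℕ : ℕ → ℚ
fromℕ n = ratio n 1

fromℕ-suc : ∀ b → fromℕ (suc b) ≡ 1ℚ + fromℕ b
fromℕ-suc b = sym (trans (ratio-+ 1 0 b 0)
  (ratio-≡ (1 ℕ.* 1 ℕ.+ b ℕ.* 1) 0 (suc b) 0 (cong (λ t → suc t ℕ.* 1) (ℕₚ.*-identityʳ b))))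

fromℕ-mono-≤ : ∀ {m n} → m ℕ.≤ n → fromℕ m ≤ fromℕ n
fromℕ-mono-≤ {m} {n} h = ratio-≤ m 0 n 0 (ℕₚ.*-monoˡ-≤ 1 h)

ratio-inverse : ∀ m → fromℕ (suc m) * ratio 1 (suc m) ≡ 1ℚ
ratio-inverse m = trans (ratio-* (suc m) 0 1 m) (ratio-≡ (suc m ℕ.* 1) (m ℕ.+ 0 ℕ.* suc m) 1 0 eq)
  where
  eq : suc m ℕ.* 1 ℕ.* 1 ≡ 1 ℕ.* suc (m ℕ.+ 0 ℕ.* suc m)
  eq rewrite ℕₚ.*-identityʳ (suc m ℕ.* 1) | ℕₚ.*-identityʳ (suc m) | ℕₚ.+-identityʳ m | ℕₚ.+-identityʳ m = refl

fromℕ-*-ratio-cancel : ∀ {k} → (∃ λ m → k ≡ suc m) → ∀ z → fromℕ k * (ratio 1 k * z) ≡ z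
fromℕ-*-ratio-cancel (m , refl) z = begin
  fromℕ (suc m) * (ratio 1 (suc m) * z) ≡⟨ ℚₚ.*-assoc (fromℕ (suc m)) (ratio 1 (suc m)) z ⟨
  fromℕ (suc m) * ratio 1 (suc m) * z   ≡⟨ cong (_* z) (ratio-inverse m) ⟩
  1ℚ * z                                ≡⟨ ℚₚ.*-identityˡ z ⟩
  z                                     ∎
  where open ≡-Reasoning

*-nonNeg : ∀ {x y} → 0ℚ ≤ x → 0ℚ ≤ y → 0ℚ ≤ x * y
*-nonNeg {x} {y} hx hy = subst (_≤ x * y) (ℚₚ.*-zeroˡ y) (ℚₚ.*-monoʳ-≤-nonNeg y {{ℚ.nonNegative hy}} hx)

*-monoʳ-≤-0≤ : ∀ {c x y} → 0ℚ ≤ c → x ≤ y → c * x ≤ c * y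
*-monoʳ-≤-0≤ {c} hc = ℚₚ.*-monoˡ-≤-nonNeg c {{ℚ.nonNegative hc}}

*-monoˡ-≤-0≤ : ∀ {c x y} → 0ℚ ≤ c → x ≤ y → x * c ≤ y * c
*-monoˡ-≤-0≤ {c} hc = ℚₚ.*-monoʳ-≤-nonNeg c {{ℚ.nonNegative hc}}

fromℕ-suc-cancelˡ-≤ : ∀ m {x y} → fromℕ (suc m) * x ≤ fromℕ (suc m) * y → x ≤ y
fromℕ-suc-cancelˡ-≤ m {x} {y} h =
  subst₂ _≤_ (cancel x) (cancel y) (*-monoʳ-≤-0≤ (ratio-nonNeg 1 (suc m)) h)
  where
  cancel : ∀ z → ratio 1 (suc m) * (fromℕ (suc m) * z) ≡ z
  cancel z = begin
    ratio 1 (suc m) * (fromℕ (suc m) * z) ≡⟨ ℚₚ.*-assoc (ratio 1 (suc m)) (fromℕ (suc m)) z ⟨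
    ratio 1 (suc m) * fromℕ (suc m) * z   ≡⟨ cong (_* z) (trans (ℚₚ.*-comm (ratio 1 (suc m)) _) (ratio-inverse m)) ⟩
    1ℚ * z                                ≡⟨ ℚₚ.*-identityˡ z ⟩
    z                                     ∎
    where open ≡-Reasoning

fromℕ-suc-cancelˡ-≡ : ∀ m {x y} → fromℕ (suc m) * x ≡ fromℕ (suc m) * y → x ≡ y
fromℕ-suc-cancelˡ-≡ m h =
  ℚₚ.≤-antisym (fromℕ-suc-cancelˡ-≤ m (ℚₚ.≤-reflexive h)) (fromℕ-suc-cancelˡ-≤ m (ℚₚ.≤-reflexive (sym h)))

+-interchange : ∀ a b c d → (a + b) + (c + d) ≡ (a + c) + (b + d)
+-interchange = CommutativeSemigroupₚ.interchange (CommutativeMonoid.commutativeSemigroup ℚₚ.+-0-commutativeMonoid)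

module _ {A : Set} where

  sumℚ-nonNeg : ∀ (φ : A → ℚ) L → (∀ {x} → x ∈ L → 0ℚ ≤ φ x) → 0ℚ ≤ sumℚ (map φ L)
  sumℚ-nonNeg φ [] h = ℚₚ.≤-refl
  sumℚ-nonNeg φ (x ∷ L) h = ℚₚ.+-mono-≤ (h (here refl)) (sumℚ-nonNeg φ L (h ∘ there))

  sumℚ-mono : ∀ (φ ψ : A → ℚ) L → (∀ {x} → x ∈ L → φ x ≤ ψ x) → sumℚ (map φ L) ≤ sumℚ (map ψ L)
  sumℚ-mono φ ψ [] h = ℚₚ.≤-refl
  sumℚ-mono φ ψ (x ∷ L) h = ℚₚ.+-mono-≤ (h (here refl)) (sumℚ-mono φ ψ L (h ∘ there))

  sumℚ-cong : ∀ (φ ψ : A → ℚ) L → (∀ {x} → x ∈ L → φ x ≡ ψ x) → sumℚ (map φ L) ≡ sumℚ (map ψ L)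
  sumℚ-cong φ ψ L h = cong sumℚ (Listₚ.map-cong-local (All.tabulate h))

  sumℚ-+ : ∀ (φ ψ : A → ℚ) L → sumℚ (map (λ x → φ x + ψ x) L) ≡ sumℚ (map φ L) + sumℚ (map ψ L)
  sumℚ-+ φ ψ [] = refl
  sumℚ-+ φ ψ (x ∷ L) = trans (cong ((φ x + ψ x) +_) (sumℚ-+ φ ψ L)) (+-interchange (φ x) (ψ x) _ _)

  sumℚ-filterᵇ : ∀ (φ : A → ℚ) q L → sumℚ (map φ (filterᵇ q L)) ≡ sumℚ (map (λ x → if q x then φ x else 0ℚ) L)
  sumℚ-filterᵇ φ q [] = refl
  sumℚ-filterᵇ φ q (x ∷ L) with q x
  ... | true = cong (φ x +_) (sumℚ-filterᵇ φ q L)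
  ... | false = trans (sumℚ-filterᵇ φ q L) (sym (ℚₚ.+-identityˡ _))

  sumℚ-scale-filterᵇ : ∀ (q : A → Bool) (r : ℚ) (φ : A → ℚ) L →
    sumℚ (map (λ x → if q x then r * φ x else 0ℚ) L) ≡ r * sumℚ (map φ (filterᵇ q L))
  sumℚ-scale-filterᵇ q r φ [] = sym (ℚₚ.*-zeroʳ r)
  sumℚ-scale-filterᵇ q r φ (x ∷ L) with q x
  ... | true = trans (cong (r * φ x +_) (sumℚ-scale-filterᵇ q r φ L)) (sym (ℚₚ.*-distribˡ-+ r (φ x) _))
  ... | false = trans (ℚₚ.+-identityˡ _) (sumℚ-scale-filterᵇ q r φ L)

sumℚ-↭ : ∀ {xs ys} → xs ↭ ys → sumℚ xs ≡ sumℚ ys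
sumℚ-↭ Perm.refl = refl
sumℚ-↭ (prep x p) = cong (x +_) (sumℚ-↭ p)
sumℚ-↭ (swap x y p) = trans (sym (ℚₚ.+-assoc x y _))
  (trans (cong₂ _+_ (ℚₚ.+-comm x y) (sumℚ-↭ p)) (ℚₚ.+-assoc y x _))
sumℚ-↭ (Perm.trans p q) = trans (sumℚ-↭ p) (sumℚ-↭ q)

sumℚ-extract : ∀ (φ : ℕ → ℚ) {v} V → v ∈ V → Unique V →
  sumℚ (map φ V) ≡ φ v + sumℚ (map φ (filterᵇ (neq v) V))
sumℚ-extract φ V v∈ u = sumℚ-↭ (Permₚ.map⁺ φ (↭-extract V v∈ u))

-- Satisfiable literals and the recursion for p

litsOver-var : ∀ {m} vs → m ∈ litsOver vs → var m ∈ vs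
litsOver-var (x ∷ vs) (here refl) = here refl
litsOver-var (x ∷ vs) (there (here refl)) = here refl
litsOver-var (x ∷ vs) (there (there m)) = there (litsOver-var vs m)

∈-litsOver : ∀ {m} vs → var m ∈ vs → m ∈ litsOver vs
∈-litsOver {lit x false} (.x ∷ vs) (here refl) = here refl
∈-litsOver {lit x true} (.x ∷ vs) (here refl) = there (here refl)
∈-litsOver (y ∷ vs) (there m) = there (there (∈-litsOver vs m))

filterᵇ-litTrue-litsOver : ∀ α V → filterᵇ (litTrue α) (litsOver V) ≡ map (αlit α) V
filterᵇ-litTrue-litsOver α [] = refl
filterᵇ-litTrue-litsOver α (x ∷ V) = by-value (α x) refl
  where
  by-value : ∀ b → α x ≡ b → filterᵇ (litTrue α) (litsOver (x ∷ V)) ≡ map (αlit α) (x ∷ V)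
  by-value false e = trans (filterᵇ-accept (litTrue α) _ (cong (λ t → beq t false) e))
     (trans (cong (lit x false ∷_) (filterᵇ-reject (litTrue α) _ (cong (λ t → beq t true) e)))
     (cong₂ _∷_ (cong (lit x) (sym e)) (filterᵇ-litTrue-litsOver α V)))
  by-value true e = trans (filterᵇ-reject (litTrue α) _ (cong (λ t → beq t false) e))
     (trans (filterᵇ-accept (litTrue α) _ (cong (λ t → beq t true) e))
     (cong₂ _∷_ (cong (lit x) (sym e)) (filterᵇ-litTrue-litsOver α V)))

slB : CNF → Lit → Bool
slB F l = satisfiableB (restrict l F)

∈-SL⁻ : ∀ {m} F → m ∈ SL F → (var m ∈ vars F) × Satisfiable (restrict m F)
∈-SL⁻ {m} F m∈ with ∈-filterᵇ⁻ (slB F) (litsOver (vars F)) m∈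
... | m∈lits , e = litsOver-var (vars F) m∈lits , satisfiableB-sound (restrict m F) e

slB-αlit : ∀ F α v → WellScoped F → satB F α ≡ true → slB F (αlit α v) ≡ true
slB-αlit F α v ws s = satisfiableB-complete (restrict (αlit α v) F) (restrict-WellScoped _ F ws)
  (α , ≡→T (satB-restrict F α (αlit α v) s (αlit-true α v)))

filterᵇ-litTrue-SL : ∀ F α → WellScoped F → satB F α ≡ true → filterᵇ (litTrue α) (SL F) ≡ map (αlit α) (vars F)
filterᵇ-litTrue-SL F α ws s = begin
  filterᵇ (litTrue α) (filterᵇ (slB F) (litsOver (vars F))) ≡⟨ filterᵇ-comm (litTrue α) (slB F) (litsOver (vars F)) ⟩
  filterᵇ (slB F) (filterᵇ (litTrue α) (litsOver (vars F))) ≡⟨ cong (filterᵇ (slB F)) (filterᵇ-litTrue-litsOver α (vars F)) ⟩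
  filterᵇ (slB F) (map (αlit α) (vars F))                   ≡⟨ filterᵇ-all (slB F) _ all-sl ⟩
  map (αlit α) (vars F)                                     ∎
  where
  open ≡-Reasoning
  all-sl : ∀ {l} → l ∈ map (αlit α) (vars F) → slB F l ≡ true
  all-sl m with ∈-map⁻ (αlit α) m
  ... | x , _ , refl = slB-αlit F α x ws s

-- The process can only output α by picking one of the literals α(x), x ∈ V(F).
childSum : CNF → Assignment → ℚ
childSum F α = sumℚ (map (λ x → p (restrict (αlit α x) F) α) (vars F))

p-unfold : ∀ F α y ys → WellScoped F → Unique (vars F) → satB F α ≡ true → vars F ≡ y ∷ ys →
  p F α ≡ ratio 1 (length (SL F)) * childSum F α
p-unfold F@(cnf cs _) α y ys ws u s refl = begin
  pAux (suc (length ys)) F α                                      ≡⟨ sumℚ-scale-filterᵇ (litTrue α) r g (SL F) ⟩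
  r * sumℚ (map g (filterᵇ (litTrue α) (SL F)))                   ≡⟨ cong (λ L → r * sumℚ (map g L)) (filterᵇ-litTrue-SL F α ws s) ⟩
  r * sumℚ (map g (map (αlit α) (vars F)))                        ≡⟨ cong (λ L → r * sumℚ L) (Listₚ.map-∘ {g = g} {f = αlit α} (vars F)) ⟨
  r * sumℚ (map (g ∘ αlit α) (vars F))                            ≡⟨ cong (r *_) (sumℚ-cong _ _ (vars F) fuel-suffices) ⟩
  r * childSum F α                                                ∎
  where
  open ≡-Reasoning
  r : ℚ
  r = ratio 1 (length (SL F))
  g : Lit → ℚ
  g l = pAux (length ys) (restrict l F) α
  fuel-suffices : ∀ {x} → x ∈ vars F → g (αlit α x) ≡ p (restrict (αlit α x) F) α
  fuel-suffices x∈ = cong (λ n → pAux n (restrict (αlit α _) F) α)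
    (ℕₚ.suc-injective (sym (length-vars-extract (vars F) x∈ u)))

childSum≡|SL|*p : ∀ F α → WellScoped F → Unique (vars F) → satB F α ≡ true → childSum F α ≡ fromℕ (length (SL F)) * p F α
childSum≡|SL|*p (cnf cs []) α ws u s = sym (ℚₚ.*-zeroˡ (p (cnf cs []) α))
childSum≡|SL|*p F@(cnf cs (y ∷ ys)) α ws u s = begin
  childSum F α                                               ≡⟨ fromℕ-*-ratio-cancel |SL|≢0 (childSum F α) ⟨
  fromℕ (length (SL F)) * (ratio 1 (length (SL F)) * childSum F α) ≡⟨ cong (fromℕ (length (SL F)) *_) (p-unfold F α y ys ws u s refl) ⟨
  fromℕ (length (SL F)) * p F α                              ∎
  where
  open ≡-Reasoning
  |SL|≢0 : ∃ λ m → length (SL F) ≡ suc m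
  |SL|≢0 = filterᵇ-nonEmpty (litTrue α) (SL F) (filterᵇ-litTrue-SL F α ws s)

pAux-nonNeg : ∀ n F α → 0ℚ ≤ pAux n F α
pAux-nonNeg n (cnf cs []) α = ratio-nonNeg 1 1
pAux-nonNeg zero (cnf cs (y ∷ ys)) α = ℚₚ.≤-refl
pAux-nonNeg (suc n) F@(cnf cs (y ∷ ys)) α = sumℚ-nonNeg _ (SL F) term-nonNeg
  where
  term-nonNeg : ∀ {l} → l ∈ SL F → 0ℚ ≤ (if litTrue α l then ratio 1 (length (SL F)) * pAux n (restrict l F) α else 0ℚ)
  term-nonNeg {l} _ with litTrue α l
  ... | true = *-nonNeg (ratio-nonNeg 1 (length (SL F))) (pAux-nonNeg n (restrict l F) α)
  ... | false = ℚₚ.≤-refl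

p-nonNeg : ∀ F α → 0ℚ ≤ p F α
p-nonNeg F α = pAux-nonNeg _ F α

count1 : ∀ {A : Set} → (A → Bool) → A → ℕ
count1 q x = if q x then 1 else 0

length-filterᵇ-∷ : ∀ {A : Set} (q : A → Bool) x xs → length (filterᵇ q (x ∷ xs)) ≡ count1 q x ℕ.+ length (filterᵇ q xs)
length-filterᵇ-∷ q x xs with q x
... | true = refl
... | false = refl

length-filterᵇ-mono : ∀ {A : Set} (p q : A → Bool) xs → (∀ {x} → x ∈ xs → p x ≡ true → q x ≡ true) →
  length (filterᵇ p xs) ℕ.≤ length (filterᵇ q xs)
length-filterᵇ-mono p q [] h = ℕ.z≤n
length-filterᵇ-mono p q (x ∷ xs) h rewrite length-filterᵇ-∷ p x xs | length-filterᵇ-∷ q x xs =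
  ℕₚ.+-mono-≤ head-≤ (length-filterᵇ-mono p q xs (h ∘ there))
  where
  head-≤ : count1 p x ℕ.≤ count1 q x
  head-≤ with p x in px
  ... | false = ℕ.z≤n
  ... | true rewrite h (here refl) px = ℕₚ.≤-refl

countVar : (Lit → Bool) → ℕ → ℕ
countVar q v = count1 q (lit v false) ℕ.+ count1 q (lit v true)

countVar-pos : ∀ q v b → q (lit v b) ≡ true → 1 ℕ.≤ countVar q v
countVar-pos q v false e rewrite e = ℕ.s≤s ℕ.z≤n
countVar-pos q v true e rewrite e = ℕₚ.m≤n+m 1 (count1 q (lit v false))

countVar-one : ∀ q v b → q (lit v b) ≡ true → q (lit v (not b)) ≡ false → countVar q v ≡ 1
countVar-one q v false e e′ rewrite e | e′ = refl
countVar-one q v true e e′ rewrite e | e′ = refl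

length-filterᵇ-litsOver-extract : ∀ (q : Lit → Bool) {v} V → v ∈ V → Unique V →
  length (filterᵇ q (litsOver V)) ≡ countVar q v ℕ.+ length (filterᵇ q (litsOver (filterᵇ (neq v) V)))
length-filterᵇ-litsOver-extract q {v} V v∈ u = begin
  length (filterᵇ q (litsOver V))                                           ≡⟨ Permₚ.↭-length (Permₚ.filter-↭ (T? ∘ q) lits↭) ⟩
  length (filterᵇ q (lit v false ∷ lit v true ∷ litsOver W))                ≡⟨ length-filterᵇ-∷ q _ _ ⟩
  count1 q (lit v false) ℕ.+ length (filterᵇ q (lit v true ∷ litsOver W))   ≡⟨ cong (count1 q (lit v false) ℕ.+_) (length-filterᵇ-∷ q _ _) ⟩
  count1 q (lit v false) ℕ.+ (count1 q (lit v true) ℕ.+ length (filterᵇ q (litsOver W))) ≡⟨ ℕₚ.+-assoc (count1 q (lit v false)) (count1 q (lit v true)) (length (filterᵇ q (litsOver W))) ⟨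
  countVar q v ℕ.+ length (filterᵇ q (litsOver W))                          ∎
  where
  open ≡-Reasoning
  W : List ℕ
  W = filterᵇ (neq v) V
  lits↭ : litsOver V ↭ lit v false ∷ lit v true ∷ litsOver W
  lits↭ = concatMap-↭ _ (↭-extract V v∈ u)

slB-restrict⇒slB : ∀ F α v m → WellScoped F → var m ≢ v → slB (restrict (αlit α v) F) m ≡ true → slB F m ≡ true
slB-restrict⇒slB F α v m ws m≢v e with satisfiableB-sound (restrict m (restrict (αlit α v) F)) e
... | β , s = satisfiableB-complete (restrict m F) (restrict-WellScoped m F ws)
   (update v (α v) β , ≡→T (satB-update (restrict m F) β (αlit α v)
     (trans (cong (λ G → satB G β) (restrict-comm (αlit α v) m F (m≢v ∘ sym))) (T→≡ s))))

-- A satisfying assignment of F^[m] already sets the frozen v to α(v).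
slB⇒slB-restrict : ∀ F α v m → WellScoped F → satB F α ≡ true → Frozen F v → var m ≢ v →
  slB F m ≡ true → slB (restrict (αlit α v) F) m ≡ true
slB⇒slB-restrict F α v m ws s (_ , frozen) m≢v e with satisfiableB-sound (restrict m F) e
... | β , sβ = satisfiableB-complete (restrict m (restrict (αlit α v) F))
                 (restrict-WellScoped m _ (restrict-WellScoped _ F ws)) (β , ≡→T sat)
  where
  βv : litTrue β (αlit α v) ≡ true
  βv = trans (cong (λ t → beq t (α v)) (trans (sym (update-≢ (sign m) β (m≢v ∘ sym)))
               (frozen (update (var m) (sign m) β) α (≡→T (satB-update F β m (T→≡ sβ))) (≡→T s))))
             (beq-refl (α v))
  sat : satB (restrict m (restrict (αlit α v) F)) β ≡ true
  sat = trans (cong (λ G → satB G β) (restrict-comm m (αlit α v) F m≢v))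
              (satB-restrict (restrict m F) β (αlit α v) (T→≡ sβ) βv)

slB-frozen-neg : ∀ F α v → satB F α ≡ true → Frozen F v → slB F (lit v (not (α v))) ≡ false
slB-frozen-neg F α v s (_ , frozen) with slB F (lit v (not (α v))) in e
... | false = refl
... | true with satisfiableB-sound (restrict (lit v (not (α v))) F) e
... | β , sβ = ⊥-elim (not-≢-self (α v) (trans (sym (update-≡ v (not (α v)) β))
                 (frozen (update v (not (α v)) β) α (≡→T (satB-update F β (lit v (not (α v))) (T→≡ sβ))) (≡→T s))))

SL-length-split : ∀ F v → WF F → v ∈ vars F →
  length (SL F) ≡ countVar (slB F) v ℕ.+ length (filterᵇ (slB F) (litsOver (filterᵇ (neq v) (vars F))))
SL-length-split F v (u , _) v∈ = length-filterᵇ-litsOver-extract (slB F) (vars F) v∈ u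

length-SL-restrict-< : ∀ F α v → WF F → satB F α ≡ true → v ∈ vars F →
  suc (length (SL (restrict (αlit α v) F))) ℕ.≤ length (SL F)
length-SL-restrict-< F α v wf s v∈ = subst (suc (length (SL Fv)) ℕ.≤_) (sym (SL-length-split F v wf v∈))
  (ℕₚ.+-mono-≤ (countVar-pos (slB F) v (α v) (slB-αlit F α v ws s))
               (length-filterᵇ-mono (slB Fv) (slB F) _ fewer))
  where
  ws : WellScoped F
  ws = WF⇒WellScoped wf
  Fv : CNF
  Fv = restrict (αlit α v) F
  fewer : ∀ {m} → m ∈ litsOver (vars Fv) → slB Fv m ≡ true → slB F m ≡ true
  fewer m∈ = slB-restrict⇒slB F α v _ ws (proj₂ (vars-restrict-∈ (αlit α v) F (litsOver-var _ m∈)))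

length-SL-restrict-frozen : ∀ F α v → WF F → satB F α ≡ true → Frozen F v →
  length (SL F) ≡ suc (length (SL (restrict (αlit α v) F)))
length-SL-restrict-frozen F α v wf s fz@(v∈ , _) = trans (SL-length-split F v wf v∈)
  (cong₂ ℕ._+_ (countVar-one (slB F) v (α v) (slB-αlit F α v ws s) (slB-frozen-neg F α v s fz))
               (cong length (filterᵇ-cong (slB F) (slB Fv) _ same)))
  where
  ws : WellScoped F
  ws = WF⇒WellScoped wf
  Fv : CNF
  Fv = restrict (αlit α v) F
  same : ∀ {m} → m ∈ litsOver (vars Fv) → slB F m ≡ slB Fv m
  same {m} m∈ = Bool-ext (slB⇒slB-restrict F α v m ws s fz m≢v) (slB-restrict⇒slB F α v m ws m≢v)
    where
    m≢v : var m ≢ v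
    m≢v = proj₂ (vars-restrict-∈ (αlit α v) F (litsOver-var _ m∈))

-- Monotonicity of p under restriction

Frozen-restrict : ∀ F v b x → x ≢ v → Frozen F v → Frozen (restrict (lit x b) F) v
Frozen-restrict F v b x x≢v (v∈ , frozen) = ∈-vars-restrict (lit x b) F v∈ (x≢v ∘ sym) ,
  λ β γ sβ sγ → trans (sym (update-≢ b β (x≢v ∘ sym)))
    (trans (frozen (update x b β) (update x b γ) (≡→T (satB-update F β (lit x b) (T→≡ sβ))) (≡→T (satB-update F γ (lit x b) (T→≡ sγ))))
           (update-≢ b γ (x≢v ∘ sym)))

otherChildren : CNF → Assignment → ℕ → ℚ
otherChildren F α v = sumℚ (map (λ x → p (restrict (αlit α x) F) α) (filterᵇ (neq v) (vars F)))

|SL|*p-split : ∀ F α v → WF F → satB F α ≡ true → v ∈ vars F →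
  fromℕ (length (SL F)) * p F α ≡ p (restrict (αlit α v) F) α + otherChildren F α v
|SL|*p-split F α v wf@(u , _) s v∈ = trans (sym (childSum≡|SL|*p F α (WF⇒WellScoped wf) u s))
  (sumℚ-extract (λ x → p (restrict (αlit α x) F) α) (vars F) v∈ u)

suc|SL|*p : ∀ G α → WF G → satB G α ≡ true → fromℕ (suc (length (SL G))) * p G α ≡ p G α + childSum G α
suc|SL|*p G α wf@(u , _) s = begin
  fromℕ (suc b) * p G α            ≡⟨ cong (_* p G α) (fromℕ-suc b) ⟩
  (1ℚ + fromℕ b) * p G α           ≡⟨ ℚₚ.*-distribʳ-+ (p G α) 1ℚ (fromℕ b) ⟩
  1ℚ * p G α + fromℕ b * p G α     ≡⟨ cong₂ _+_ (ℚₚ.*-identityˡ (p G α)) (sym (childSum≡|SL|*p G α (WF⇒WellScoped wf) u s)) ⟩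
  p G α + childSum G α             ∎
  where
  open ≡-Reasoning
  b : ℕ
  b = length (SL G)

-- The children of F^[α(v)] are the F^[α(x)]^[α(v)], x ≠ v, which are smaller instances.
restrict-child : ∀ F α v {x} → x ∈ filterᵇ (neq v) (vars F) →
  p (restrict (αlit α x) (restrict (αlit α v) F)) α ≡ p (restrict (αlit α v) (restrict (αlit α x) F)) α
restrict-child F α v x∈ = cong (λ G → p G α) (restrict-comm _ _ F (proj₂ (vars-restrict-∈ (αlit α v) F x∈)))

p-restrict-mono : ∀ N F → length (vars F) ≡ N → WF F → ∀ α → satB F α ≡ true → ∀ v → v ∈ vars F →
  p F α ≤ p (restrict (αlit α v) F) α
p-restrict-mono zero F n≡0 wf α s v v∈ with vars F | n≡0 | v∈
... | [] | _ | ()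
... | _ ∷ _ | () | _
p-restrict-mono (suc N) F n≡ wf α s v v∈ with length (SL F) | length-SL-restrict-< F α v wf s v∈ | |SL|*p-split F α v wf s v∈
... | zero | () | _
... | suc a | |SLv|<|SL| | split = fromℕ-suc-cancelˡ-≤ a (begin
  fromℕ (suc a) * p F α                 ≡⟨ split ⟩
  p Fv α + otherChildren F α v          ≤⟨ ℚₚ.+-monoʳ-≤ (p Fv α) (sumℚ-mono _ _ (vars Fv) children-≤) ⟩
  p Fv α + childSum Fv α                ≡⟨ suc|SL|*p Fv α (restrict-WF _ F wf) sv ⟨
  fromℕ (suc (length (SL Fv))) * p Fv α ≤⟨ *-monoˡ-≤-0≤ (p-nonNeg Fv α) (fromℕ-mono-≤ |SLv|<|SL|) ⟩
  fromℕ (suc a) * p Fv α                ∎)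
  where
  open ℚₚ.≤-Reasoning
  Fv : CNF
  Fv = restrict (αlit α v) F
  sv : satB Fv α ≡ true
  sv = satB-restrict F α _ s (αlit-true α v)
  children-≤ : ∀ {x} → x ∈ vars Fv → p (restrict (αlit α x) F) α ≤ p (restrict (αlit α x) Fv) α
  children-≤ {x} x∈ with vars-restrict-∈ (αlit α v) F x∈
  ... | x∈V , x≢v = ℚₚ.≤-trans
    (p-restrict-mono N (restrict (αlit α x) F)
      (ℕₚ.suc-injective (trans (length-vars-extract (vars F) x∈V (proj₁ wf)) n≡))
      (restrict-WF _ F wf) α (satB-restrict F α _ s (αlit-true α x)) v (∈-vars-restrict (αlit α x) F v∈ (x≢v ∘ sym)))
    (ℚₚ.≤-reflexive (sym (restrict-child F α v x∈)))

p-restrict-frozen : ∀ N F → length (vars F) ≡ N → WF F → ∀ α → satB F α ≡ true → ∀ v → Frozen F v →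
  p (restrict (αlit α v) F) α ≡ p F α
p-restrict-frozen zero F n≡0 wf α s v (v∈ , _) with vars F | n≡0 | v∈
... | [] | _ | ()
... | _ ∷ _ | () | _
p-restrict-frozen (suc N) F n≡ wf α s v fz@(v∈ , _) = sym (fromℕ-suc-cancelˡ-≡ (length (SL Fv)) (begin
  fromℕ (suc (length (SL Fv))) * p F α  ≡⟨ cong (λ k → fromℕ k * p F α) (length-SL-restrict-frozen F α v wf s fz) ⟨
  fromℕ (length (SL F)) * p F α         ≡⟨ |SL|*p-split F α v wf s v∈ ⟩
  p Fv α + otherChildren F α v          ≡⟨ cong (p Fv α +_) (sumℚ-cong _ _ (vars Fv) children-≡) ⟩
  p Fv α + childSum Fv α                ≡⟨ suc|SL|*p Fv α (restrict-WF _ F wf) sv ⟨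
  fromℕ (suc (length (SL Fv))) * p Fv α ∎))
  where
  open ≡-Reasoning
  Fv : CNF
  Fv = restrict (αlit α v) F
  sv : satB Fv α ≡ true
  sv = satB-restrict F α _ s (αlit-true α v)
  children-≡ : ∀ {x} → x ∈ vars Fv → p (restrict (αlit α x) F) α ≡ p (restrict (αlit α x) Fv) α
  children-≡ {x} x∈ with vars-restrict-∈ (αlit α v) F x∈
  ... | x∈V , x≢v = trans
    (sym (p-restrict-frozen N (restrict (αlit α x) F)
      (ℕₚ.suc-injective (trans (length-vars-extract (vars F) x∈V (proj₁ wf)) n≡))
      (restrict-WF _ F wf) α (satB-restrict F α _ s (αlit-true α x)) v (Frozen-restrict F v (α x) x x≢v fz)))
    (sym (restrict-child F α v x∈))

-- Sub-formulas of size at most s and s-implication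

⊆-map⁻ : ∀ {A B : Set} (f : A → B) {S} ys → S ⊆ map f ys → ∃ λ K → K ⊆ ys × (S ≡ map f K)
⊆-map⁻ f [] [] = [] , [] , refl
⊆-map⁻ f (y ∷ ys) (.(f y) ∷ʳ S⊆) with ⊆-map⁻ f ys S⊆
... | K , K⊆ , refl = K , y ∷ʳ K⊆ , refl
⊆-map⁻ f (y ∷ ys) (refl ∷ S⊆) with ⊆-map⁻ f ys S⊆
... | K , K⊆ , refl = y ∷ K , refl ∷ K⊆ , refl

filterᵇ-⊆ : ∀ {A : Set} (p : A → Bool) xs → filterᵇ p xs ⊆ xs
filterᵇ-⊆ p = Sublistₚ.filter-⊆ (T? ∘ p)

filterᵇ⁺-⊆ : ∀ {A : Set} (p : A → Bool) {xs ys} → xs ⊆ ys → filterᵇ p xs ⊆ filterᵇ p ys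
filterᵇ⁺-⊆ p = Sublistₚ.filter⁺ (T? ∘ p) (T? ∘ p) (λ { refl px → px })

∈-subsetsUpTo⁻ : ∀ {A : Set} s (cs : List A) {G} → G ∈ subsetsUpTo s cs → G ⊆ cs × (length G ℕ.≤ s)
∈-subsetsUpTo⁻ s [] (here refl) = [] , ℕ.z≤n
∈-subsetsUpTo⁻ zero (x ∷ cs) (here refl) = Sublist.minimum (x ∷ cs) , ℕ.z≤n
∈-subsetsUpTo⁻ (suc s) (x ∷ cs) m with ∈-++⁻ (map (x ∷_) (subsetsUpTo s cs)) m
... | inj₁ m₁ with ∈-map⁻ (x ∷_) m₁
...   | G , G∈ , refl with ∈-subsetsUpTo⁻ s cs G∈
...     | G⊆ , |G|≤ = refl ∷ G⊆ , ℕ.s≤s |G|≤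
∈-subsetsUpTo⁻ (suc s) (x ∷ cs) m | inj₂ m₂ with ∈-subsetsUpTo⁻ (suc s) cs m₂
... | G⊆ , |G|≤ = x ∷ʳ G⊆ , |G|≤

∈-subsetsUpTo⁺ : ∀ {A : Set} s {G cs : List A} → G ⊆ cs → length G ℕ.≤ s → G ∈ subsetsUpTo s cs
∈-subsetsUpTo⁺ s [] _ = here refl
∈-subsetsUpTo⁺ zero {[]} (_ ∷ʳ _) _ = here refl
∈-subsetsUpTo⁺ zero {_ ∷ _} (_ ∷ʳ _) ()
∈-subsetsUpTo⁺ zero (_ ∷ _) ()
∈-subsetsUpTo⁺ (suc s) {_} {y ∷ ys} (_ ∷ʳ G⊆) |G|≤ =
  ∈-++⁺ʳ (map (y ∷_) (subsetsUpTo s ys)) (∈-subsetsUpTo⁺ (suc s) G⊆ |G|≤)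
∈-subsetsUpTo⁺ (suc s) (refl ∷ G⊆) (ℕ.s≤s |G|≤) = ∈-++⁺ˡ (∈-map⁺ (_ ∷_) (∈-subsetsUpTo⁺ s G⊆ |G|≤))

impliesB⁻ : ∀ G vs m → All (All (λ l → var l ∈ vs)) G → var m ∈ vs → impliesB G vs m ≡ true →
  ∀ β → all (clauseTrue β) G ≡ true → litTrue β m ≡ true
impliesB⁻ G vs m G-over m∈ e β sβ with allAssign-complete vs β
... | a , a∈ , ag with all⁻ _ (allAssign vs) e a∈
... | ea rewrite all-clauseTrue-Agree G G-over ag | sβ = trans (sym (litTrue-Agree m m∈ ag)) ea

impliesB⁺ : ∀ G vs m → (∀ β → all (clauseTrue β) G ≡ true → litTrue β m ≡ true) → impliesB G vs m ≡ true
impliesB⁺ G vs m h = all⁺ _ (allAssign vs) g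
  where
  g : ∀ {a} → a ∈ allAssign vs → (not (all (clauseTrue a) G) ∨ litTrue a m) ≡ true
  g {a} _ with all (clauseTrue a) G in e
  ... | true = h a e
  ... | false = refl

sImpliedB⁻ : ∀ s G m → sImpliedB s G m ≡ true →
  ∃ λ G′ → G′ ⊆ clauses G × length G′ ℕ.≤ s × impliesB G′ (vars G) m ≡ true
sImpliedB⁻ s G m e with any⁻ _ (subsetsUpTo s (clauses G)) e
... | G′ , G′∈ , i = let G′⊆ , |G′|≤ = ∈-subsetsUpTo⁻ s (clauses G) G′∈ in G′ , G′⊆ , |G′|≤ , i

sImpliedB⁺ : ∀ s G m G′ → G′ ⊆ clauses G → length G′ ℕ.≤ s → impliesB G′ (vars G) m ≡ true → sImpliedB s G m ≡ true
sImpliedB⁺ s G m G′ G′⊆ |G′|≤ = any⁺ _ (subsetsUpTo s (clauses G)) (∈-subsetsUpTo⁺ s G′⊆ |G′|≤)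

map-filterᵇ-map-filterᵇ : ∀ {X : Set} (h f f′ : X → X) (k g g′ : X → Bool) cs →
  (∀ {C} → C ∈ cs → g′ C ≡ g C ∧ k (f C)) → (∀ {C} → C ∈ cs → g′ C ≡ true → h (f C) ≡ f′ C) →
  map h (filterᵇ k (map f (filterᵇ g cs))) ≡ map f′ (filterᵇ g′ cs)
map-filterᵇ-map-filterᵇ h f f′ k g g′ [] h1 h2 = refl
map-filterᵇ-map-filterᵇ h f f′ k g g′ (C ∷ cs) h1 h2 = by-tests (g C) refl (k (f C)) refl
  where
  ih : map h (filterᵇ k (map f (filterᵇ g cs))) ≡ map f′ (filterᵇ g′ cs)
  ih = map-filterᵇ-map-filterᵇ h f f′ k g g′ cs (λ m → h1 (there m)) (λ m → h2 (there m))
  by-tests : ∀ b → g C ≡ b → ∀ c → k (f C) ≡ c → map h (filterᵇ k (map f (filterᵇ g (C ∷ cs)))) ≡ map f′ (filterᵇ g′ (C ∷ cs))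
  by-tests true e1 true e2 = trans (cong (λ z → map h (filterᵇ k (map f z))) (filterᵇ-accept g cs e1))
     (trans (cong (map h) (filterᵇ-accept k _ e2))
     (trans (cong₂ _∷_ (h2 (here refl) g′C) ih) (sym (cong (map f′) (filterᵇ-accept g′ cs g′C)))))
    where
    g′C : g′ C ≡ true
    g′C = trans (h1 (here refl)) (cong₂ _∧_ e1 e2)
  by-tests true e1 false e2 = trans (cong (λ z → map h (filterᵇ k (map f z))) (filterᵇ-accept g cs e1))
     (trans (cong (map h) (filterᵇ-reject k _ e2))
     (trans ih (sym (cong (map f′) (filterᵇ-reject g′ cs (trans (h1 (here refl)) (cong₂ _∧_ e1 e2)))))))
  by-tests false e1 c e2 = trans (cong (λ z → map h (filterᵇ k (map f z))) (filterᵇ-reject g cs e1))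
     (trans ih (sym (cong (map f′) (filterᵇ-reject g′ cs (trans (h1 (here refl)) (cong (_∧ k (f C)) e1))))))

-- pin P is F restricted by α on every variable outside P (P is the set of free variables).
-- All formulas met by PPSZ on F with assignment α are of this form.
module Pinning (F : CNF) (α : Assignment) where

  pinnedTrue : (ℕ → Bool) → Lit → Bool
  pinnedTrue P m = not (P (var m)) ∧ litTrue α m

  keptB : (ℕ → Bool) → Clause → Bool
  keptB P C = not (any (pinnedTrue P) C)

  keepVars : (ℕ → Bool) → Clause → Clause
  keepVars P = filterᵇ (λ m → P (var m))

  pin : (ℕ → Bool) → CNF
  pin P = cnf (map (keepVars P) (filterᵇ (keptB P) (clauses F))) (filterᵇ P (vars F))

  dropVar : (ℕ → Bool) → ℕ → ℕ → Bool
  dropVar P v y = P y ∧ neq v y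

  allVars : ℕ → Bool
  allVars _ = true

  _⊒_ : (ℕ → Bool) → (ℕ → Bool) → Set
  P ⊒ Q = ∀ {y} → y ∈ vars F → Q y ≡ true → P y ≡ true

  ⊒-trans : ∀ {P Q R} → P ⊒ Q → Q ⊒ R → P ⊒ R
  ⊒-trans P⊒Q Q⊒R y∈ Ry = P⊒Q y∈ (Q⊒R y∈ Ry)

  ⊒-dropVar : ∀ P v → P ⊒ dropVar P v
  ⊒-dropVar P v _ e = proj₁ (∧-true {P _} e)

  pin-allVars : F ≡ pin allVars
  pin-allVars = sym (cong₂ cnf
    (trans (cong (map (keepVars allVars)) (filterᵇ-all (keptB allVars) (clauses F) (λ {C} _ → cong not (any-false _ C (λ _ → refl)))))
           (trans (Listₚ.map-cong-local (All.tabulate (λ {C} _ → filterᵇ-all _ C (λ _ → refl)))) (Listₚ.map-id (clauses F))))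
    (filterᵇ-all allVars (vars F) (λ _ → refl)))

  ∈-vars-pin⁻ : ∀ P {y} → y ∈ vars (pin P) → (y ∈ vars F) × (P y ≡ true)
  ∈-vars-pin⁻ P = ∈-filterᵇ⁻ P (vars F)

  ∈-vars-pin⁺ : ∀ P {y} → y ∈ vars F → P y ≡ true → y ∈ vars (pin P)
  ∈-vars-pin⁺ P = ∈-filterᵇ⁺ P (vars F)

  ∈-clauses-pin⁻ : ∀ P {C′} → C′ ∈ clauses (pin P) → ∃ λ C → (C ∈ clauses F) × (keptB P C ≡ true) × (C′ ≡ keepVars P C)
  ∈-clauses-pin⁻ P m with ∈-map⁻ (keepVars P) m
  ... | C , C∈ , refl with ∈-filterᵇ⁻ (keptB P) (clauses F) C∈
  ... | C∈F , kept = C , C∈F , kept , refl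

  memLit-keepVars : ∀ P v C → P v ≡ true → memLit (αlit α v) (keepVars P C) ≡ memLit (αlit α v) C
  memLit-keepVars P v [] Pv = refl
  memLit-keepVars P v (c ∷ C) Pv with P (var c) in Pc
  ... | true = cong (litEq (αlit α v) c ∨_) (memLit-keepVars P v C Pv)
  ... | false = trans (memLit-keepVars P v C Pv)
      (cong (_∨ memLit (αlit α v) C) (sym (litEq-≢var {αlit α v} {c} v≢c)))
    where
    v≢c : v ≢ var c
    v≢c refl with trans (sym Pv) Pc
    ... | ()

  pinnedTrue-dropVar : ∀ P v m → P v ≡ true → pinnedTrue (dropVar P v) m ≡ pinnedTrue P m ∨ litEq (αlit α v) m
  pinnedTrue-dropVar P v (lit y c) Pv with y ℕₚ.≟ v
  ... | yes refl rewrite ≡ᵇ-refl y | Pv = refl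
  ... | no y≢v rewrite ≡ᵇ-false y≢v | ≡ᵇ-false {v} {y} (y≢v ∘ sym) | Boolₚ.∧-identityʳ (P y) = sym (Boolₚ.∨-identityʳ _)

  keptB-dropVar : ∀ P v C → P v ≡ true → keptB (dropVar P v) C ≡ keptB P C ∧ avoids (αlit α v) (keepVars P C)
  keptB-dropVar P v C Pv = begin
    not (any (pinnedTrue (dropVar P v)) C)                        ≡⟨ cong not (any-cong _ _ C (λ {m} _ → pinnedTrue-dropVar P v m Pv)) ⟩
    not (any (λ m → pinnedTrue P m ∨ litEq (αlit α v) m) C)      ≡⟨ cong not (any-∨ (pinnedTrue P) (litEq (αlit α v)) C) ⟩
    not (any (pinnedTrue P) C ∨ memLit (αlit α v) C)              ≡⟨ not-∨ (any (pinnedTrue P) C) (memLit (αlit α v) C) ⟩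
    keptB P C ∧ not (memLit (αlit α v) C)                         ≡⟨ cong (λ t → keptB P C ∧ not t) (memLit-keepVars P v C Pv) ⟨
    keptB P C ∧ avoids (αlit α v) (keepVars P C)                  ∎
    where open ≡-Reasoning

  dropNeg-keepVars : ∀ P v C → memLit (αlit α v) C ≡ false → dropNeg (αlit α v) (keepVars P C) ≡ keepVars (dropVar P v) C
  dropNeg-keepVars P v C v∉C = trans (filterᵇ-filterᵇ (λ m → P (var m)) (λ m → not (litEq m (neg (αlit α v)))) C)
    (filterᵇ-cong _ _ C (λ {m} m∈ → cong (P (var m) ∧_) (differs m m∈)))
    where
    differs : ∀ m → m ∈ C → not (litEq m (neg (αlit α v))) ≡ neq v (var m)
    differs (lit y c) m∈ with y ℕₚ.≟ v
    ... | no y≢v rewrite ≡ᵇ-false y≢v = refl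
    ... | yes refl rewrite ≡ᵇ-refl y with sign-cases (α y) c
    ... | inj₁ refl with trans (sym (∈⇒memLit C m∈)) v∉C
    ... | ()
    differs (lit y c) m∈ | yes refl | inj₂ refl rewrite beq-refl (not (α y)) = refl

  restrict-pin : ∀ P v → P v ≡ true → restrict (αlit α v) (pin P) ≡ pin (dropVar P v)
  restrict-pin P v Pv = cong₂ cnf
    (map-filterᵇ-map-filterᵇ (dropNeg (αlit α v)) (keepVars P) (keepVars (dropVar P v)) (avoids (αlit α v)) (keptB P) (keptB (dropVar P v)) (clauses F)
      (λ {C} _ → keptB-dropVar P v C Pv)
      (λ {C} _ kept → dropNeg-keepVars P v C
         (trans (sym (memLit-keepVars P v C Pv)) (not-true (proj₂ (∧-true {keptB P C} (trans (sym (keptB-dropVar P v C Pv)) kept)))))))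
    (filterᵇ-filterᵇ P (neq v) (vars F))

  kept-litTrue⇒free : ∀ P C m → keptB P C ≡ true → m ∈ C → litTrue α m ≡ true → P (var m) ≡ true
  kept-litTrue⇒free P C m kept m∈ t with P (var m) in Pm
  ... | true = refl
  ... | false with trans (sym kept) (cong not (any⁺ (pinnedTrue P) C m∈ (trans (cong (λ z → not z ∧ litTrue α m) Pm) t)))
  ... | ()

  satB-pin : satB F α ≡ true → ∀ P → satB (pin P) α ≡ true
  satB-pin s P = satB⁺ (pin P) α clausewise
    where
    clausewise : ∀ {C′} → C′ ∈ clauses (pin P) → clauseTrue α C′ ≡ true
    clausewise m with ∈-clauses-pin⁻ P m
    ... | C , C∈ , kept , refl with any⁻ (litTrue α) C (satB⁻ F α s C∈)
    ... | m₀ , m₀∈ , t = any⁺ (litTrue α) (keepVars P C) (∈-filterᵇ⁺ _ C m₀∈ (kept-litTrue⇒free P C m₀ kept m₀∈ t)) t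

  pin-WellScoped : WellScoped F → ∀ P → WellScoped (pin P)
  pin-WellScoped ws P = All.tabulate clausewise
    where
    clausewise : ∀ {C′} → C′ ∈ clauses (pin P) → All (λ m → var m ∈ vars (pin P)) C′
    clausewise m with ∈-clauses-pin⁻ P m
    ... | C , C∈ , _ , refl = All.tabulate λ m′∈ → let m′∈C , Pm′ = ∈-filterᵇ⁻ _ C m′∈ in
          ∈-vars-pin⁺ P (All.lookup (All.lookup ws C∈) m′∈C) Pm′

  mix : (ℕ → Bool) → Assignment → Assignment
  mix Q β y = if Q y then β y else α y

  mix-free : ∀ Q β {y} → Q y ≡ true → mix Q β y ≡ β y
  mix-free Q β Qy rewrite Qy = refl

  mix-pinned : ∀ Q β {y} → Q y ≡ false → mix Q β y ≡ α y
  mix-pinned Q β Qy rewrite Qy = refl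

  clauseTrue-mix : ∀ P Q β C → WellScoped F → C ∈ clauses F → P ⊒ Q → keptB P C ≡ true →
    (keptB Q C ≡ true → clauseTrue β (keepVars Q C) ≡ true) → clauseTrue (mix Q β) (keepVars P C) ≡ true
  clauseTrue-mix P Q β C ws C∈ P⊒Q keptP β⊨ with keptB Q C in keptQ
  ... | true with any⁻ (litTrue β) (keepVars Q C) (β⊨ refl)
  ...   | m , m∈ , t with ∈-filterᵇ⁻ _ C m∈
  ...     | m∈C , Qm = any⁺ (litTrue (mix Q β)) (keepVars P C)
              (∈-filterᵇ⁺ _ C m∈C (P⊒Q (All.lookup (All.lookup ws C∈) m∈C) Qm))
              (trans (cong (λ t → beq t (sign m)) (mix-free Q β Qm)) t)
  clauseTrue-mix P Q β C ws C∈ P⊒Q keptP β⊨ | false with any⁻ (pinnedTrue Q) C (not-false keptQ)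
  ... | m , m∈C , pinned with ∧-true {not (Q (var m))} pinned
  ...   | ¬Qm , t = any⁺ (litTrue (mix Q β)) (keepVars P C)
            (∈-filterᵇ⁺ _ C m∈C (kept-litTrue⇒free P C m keptP m∈C t))
            (trans (cong (λ t → beq t (sign m)) (mix-pinned Q β (not-true ¬Qm))) t)

  sImpliedB-pin-mono : ∀ s P Q m → WellScoped F → P ⊒ Q → var m ∈ vars F → Q (var m) ≡ true →
    sImpliedB s (pin P) m ≡ true → sImpliedB s (pin Q) m ≡ true
  sImpliedB-pin-mono s P Q m ws P⊒Q m∈F Qm e with sImpliedB⁻ s (pin P) m e
  ... | G′ , G′⊆ , |G′|≤ , implies with ⊆-map⁻ (keepVars P) (filterᵇ (keptB P) (clauses F)) G′⊆
  ... | K , K⊆ , refl = sImpliedB⁺ s (pin Q) m G″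
        (Sublistₚ.map⁺ (keepVars Q) (filterᵇ⁺-⊆ (keptB Q) K⊆F)) |G″|≤ (impliesB⁺ G″ (vars (pin Q)) m implied)
    where
    G″ : List Clause
    G″ = map (keepVars Q) (filterᵇ (keptB Q) K)
    K⊆F : K ⊆ clauses F
    K⊆F = Sublist.⊆-trans K⊆ (filterᵇ-⊆ (keptB P) (clauses F))
    |G″|≤ : length G″ ℕ.≤ s
    |G″|≤ = ℕₚ.≤-trans (ℕₚ.≤-reflexive (Listₚ.length-map (keepVars Q) (filterᵇ (keptB Q) K)))
              (ℕₚ.≤-trans (length-filterᵇ-≤ (keptB Q) K) (subst (ℕ._≤ s) (Listₚ.length-map (keepVars P) K) |G′|≤))
    G′-over : All (All (λ l → var l ∈ vars (pin P))) (map (keepVars P) K)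
    G′-over = All.tabulate (λ C′∈ → All.lookup (pin-WellScoped ws P) (Sublist.lookup G′⊆ C′∈))
    implied : ∀ β → all (clauseTrue β) G″ ≡ true → litTrue β m ≡ true
    implied β sβ = trans (cong (λ t → beq t (sign m)) (sym (mix-free Q β Qm)))
      (impliesB⁻ (map (keepVars P) K) (vars (pin P)) m G′-over (∈-vars-pin⁺ P m∈F (P⊒Q m∈F Qm)) implies (mix Q β)
        (all⁺ _ _ mix⊨G′))
      where
      mix⊨G′ : ∀ {C′} → C′ ∈ map (keepVars P) K → clauseTrue (mix Q β) C′ ≡ true
      mix⊨G′ C′∈ with ∈-map⁻ (keepVars P) C′∈
      ... | C , C∈K , refl = clauseTrue-mix P Q β C ws (Sublist.lookup K⊆F C∈K) P⊒Q
            (proj₂ (∈-filterᵇ⁻ (keptB P) (clauses F) (Sublist.lookup K⊆ C∈K)))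
            (λ keptQ → all⁻ _ G″ sβ (∈-map⁺ (keepVars Q) (∈-filterᵇ⁺ (keptB Q) K C∈K keptQ)))

  sImpliedB-pin⇒litTrue : ∀ s P m → WellScoped F → satB F α ≡ true → var m ∈ vars (pin P) →
    sImpliedB s (pin P) m ≡ true → litTrue α m ≡ true
  sImpliedB-pin⇒litTrue s P m ws s⊨ m∈ e with sImpliedB⁻ s (pin P) m e
  ... | G′ , G′⊆ , _ , implies = impliesB⁻ G′ (vars (pin P)) m
        (All.tabulate (λ C′∈ → All.lookup (pin-WellScoped ws P) (Sublist.lookup G′⊆ C′∈))) m∈ implies α
        (all⁺ _ G′ (λ C′∈ → satB⁻ (pin P) α (satB-pin s⊨ P) (Sublist.lookup G′⊆ C′∈)))

-- The closure under s-implication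

Closed : ℕ → CNF → Set
Closed s G = findFirst (sImpliedB s G) (litsOver (vars G)) ≡ nothing

findFirst-just⁻ : ∀ q L {m} → findFirst q L ≡ just m → (m ∈ L) × (q m ≡ true)
findFirst-just⁻ q (l ∷ L) e with q l in ql
findFirst-just⁻ q (l ∷ L) refl | true = here refl , ql
... | false = let m∈ , qm = findFirst-just⁻ q L e in there m∈ , qm

findFirst-nothing⁻ : ∀ q L → findFirst q L ≡ nothing → ∀ {m} → m ∈ L → q m ≡ false
findFirst-nothing⁻ q (l ∷ L) e m∈ with q l in ql
findFirst-nothing⁻ q (l ∷ L) () m∈ | true
findFirst-nothing⁻ q (l ∷ L) e (here refl) | false = ql
findFirst-nothing⁻ q (l ∷ L) e (there m∈) | false = findFirst-nothing⁻ q L e m∈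

data ClosureStep (s n : ℕ) (G : CNF) : Set where
  stop : Closed s G → closure s (suc n) G ≡ G → ClosureStep s n G
  next : ∀ m → m ∈ litsOver (vars G) → sImpliedB s G m ≡ true →
         closure s (suc n) G ≡ closure s n (restrict m G) → ClosureStep s n G

closure-done : ∀ s n G → Closed s G → closure s (suc n) G ≡ G
closure-done s n G c rewrite c = refl

closure-unfold : ∀ s n G {m} → findFirst (sImpliedB s G) (litsOver (vars G)) ≡ just m →
  closure s (suc n) G ≡ closure s n (restrict m G)
closure-unfold s n G e rewrite e = refl

closureStep : ∀ s n G → ClosureStep s n G
closureStep s n G with findFirst (sImpliedB s G) (litsOver (vars G)) in e
... | nothing = stop e (closure-done s n G e)
... | just m = let m∈ , implied = findFirst-just⁻ _ _ e in next m m∈ implied (closure-unfold s n G e)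

Closed-empty : ∀ s G → length (vars G) ℕ.≤ 0 → Closed s G
Closed-empty s (cnf cs []) _ = refl

closure-Closed : ∀ s n G → Closed s G → closure s n G ≡ G
closure-Closed s zero G c = refl
closure-Closed s (suc n) G c with closureStep s n G
... | stop _ e = e
... | next m m∈ implied _ with trans (sym (findFirst-nothing⁻ _ _ c m∈)) implied
...   | ()

vars-closure-⊆ : ∀ s n G {y} → y ∈ vars (closure s n G) → y ∈ vars G
vars-closure-⊆ s zero G y∈ = y∈
vars-closure-⊆ s (suc n) G {y} y∈ with closureStep s n G
... | stop _ e = subst (λ H → y ∈ vars H) e y∈
... | next m _ _ e = proj₁ (vars-restrict-∈ m G (vars-closure-⊆ s n (restrict m G) (subst (λ H → y ∈ vars H) e y∈)))

length-filterᵇ-neq-< : ∀ {x} xs → x ∈ xs → Unique xs → length (filterᵇ (neq x) xs) ℕ.< length xs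
length-filterᵇ-neq-< xs x∈ u = ℕₚ.≤-reflexive (length-vars-extract xs x∈ u)

saturate : ℕ → CNF → CNF
saturate s G = closure s (length (vars G)) G

module PinnedClosure (F : CNF) (α : Assignment) (s : ℕ) (wf : WF F) (α⊨F : satB F α ≡ true) where
  open Pinning F α

  ws : WellScoped F
  ws = WF⇒WellScoped wf

  -- The implied literal is α's literal on a free variable, so one step pins that variable.
  closureStep-pin : ∀ P m → m ∈ litsOver (vars (pin P)) → sImpliedB s (pin P) m ≡ true →
    (var m ∈ vars F) × (P (var m) ≡ true) × (restrict m (pin P) ≡ pin (dropVar P (var m)))
  closureStep-pin P m m∈ implied with ∈-vars-pin⁻ P (litsOver-var _ m∈)
  ... | m∈F , Pm = m∈F , Pm , trans (cong (λ l → restrict l (pin P)) m≡αm) (restrict-pin P (var m) Pm)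
    where
    m≡αm : m ≡ αlit α (var m)
    m≡αm = litTrue⇒αlit α m (sImpliedB-pin⇒litTrue s P m ws α⊨F (litsOver-var _ m∈) implied)

  -- Otherwise m would be s-implied in the closed formula pin Q as well.
  implied-not-free : ∀ P Q m → Closed s (pin Q) → P ⊒ Q → var m ∈ vars F →
    sImpliedB s (pin P) m ≡ true → Q (var m) ≡ false
  implied-not-free P Q m closedQ P⊒Q m∈F implied with Q (var m) in Qm
  ... | false = refl
  ... | true with trans (sym (findFirst-nothing⁻ _ _ closedQ (∈-litsOver {m} _ (∈-vars-pin⁺ Q m∈F Qm))))
                        (sImpliedB-pin-mono s P Q m ws P⊒Q m∈F Qm implied)
  ...   | ()

  record PinClosure (n : ℕ) (P : ℕ → Bool) : Set where
    field
      free    : ℕ → Bool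
      result  : closure s n (pin P) ≡ pin free
      shrinks : P ⊒ free
      closed  : Closed s (pin free)
      keeps   : ∀ Q → Closed s (pin Q) → P ⊒ Q → free ⊒ Q

  closure-pin : ∀ n P → length (vars (pin P)) ℕ.≤ n → PinClosure n P
  closure-pin zero P |V|≤0 = record
    { free = P ; result = refl ; shrinks = λ _ Py → Py ; closed = Closed-empty s (pin P) |V|≤0 ; keeps = λ _ _ P⊒Q → P⊒Q }
  closure-pin (suc n) P |V|≤ with closureStep s n (pin P)
  ... | stop c e = record { free = P ; result = e ; shrinks = λ _ Py → Py ; closed = c ; keeps = λ _ _ P⊒Q → P⊒Q }
  ... | next m m∈ implied e with closureStep-pin P m m∈ implied
  ...   | m∈F , Pm , restrict≡ = record
    { free = free ; result = trans e (trans (cong (closure s n) restrict≡) result) ; shrinks = ⊒-trans (⊒-dropVar P (var m)) shrinks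
    ; closed = closed ; keeps = λ Q closedQ P⊒Q → keeps Q closedQ (dropVar-⊒ Q closedQ P⊒Q) }
    where
    |V′|≤ : length (vars (pin (dropVar P (var m)))) ℕ.≤ n
    |V′|≤ = ℕₚ.≤-pred (ℕₚ.≤-trans (ℕₚ.≤-reflexive (cong (suc ∘ length ∘ vars) (sym restrict≡)))
              (ℕₚ.≤-trans (length-filterᵇ-neq-< (vars (pin P)) (∈-vars-pin⁺ P m∈F Pm) (Uniqueₚ.filter⁺ _ (proj₁ wf))) |V|≤))
    open PinClosure (closure-pin n (dropVar P (var m)) |V′|≤)
    dropVar-⊒ : ∀ Q → Closed s (pin Q) → P ⊒ Q → dropVar P (var m) ⊒ Q
    dropVar-⊒ Q closedQ P⊒Q z∈ Qz = cong₂ _∧_ (P⊒Q z∈ Qz)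
      (neq-≢ (λ z≡m → true≢false (trans (sym Qz) (trans (cong Q z≡m) (implied-not-free P Q m closedQ P⊒Q m∈F implied)))))

  saturation : ∀ P → PinClosure (length (vars (pin P))) P
  saturation P = closure-pin _ P ℕₚ.≤-refl

  sat : (ℕ → Bool) → ℕ → Bool
  sat P = PinClosure.free (saturation P)

-- PPSZ on F simulates PPSZ on F^[α(v)]

∈⇒memℕ : ∀ y L → y ∈ L → memℕ y L ≡ true
∈⇒memℕ y L m = any⁺ (y ≡ᵇ_) L m (≡ᵇ-refl y)

∉⇒memℕ : ∀ y L → ¬ (y ∈ L) → memℕ y L ≡ false
∉⇒memℕ y L y∉ = any-false (y ≡ᵇ_) L (λ {z} z∈ → ≡ᵇ-false {y} {z} (λ { refl → y∉ z∈ }))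

memℕ⇒∈ : ∀ y L → memℕ y L ≡ true → y ∈ L
memℕ⇒∈ y L e with any⁻ (y ≡ᵇ_) L e
... | z , z∈ , y≡z rewrite ≡ᵇ-true {y} {z} y≡z = z∈

-- guessedB s β x G (y ∷ π) unfolds to guessStep s β x y π (saturate s G).
guessStep : ℕ → Assignment → ℕ → ℕ → List ℕ → CNF → Bool
guessStep s β x y π G =
  if memℕ y (vars G) then (if y ≡ᵇ x then true else guessedB s β x (restrict (lit y (β y)) G) π)
  else guessedB s β x G π

guessStep-∈ : ∀ s β x y π G → y ∈ vars G →
  guessStep s β x y π G ≡ (if y ≡ᵇ x then true else guessedB s β x (restrict (lit y (β y)) G) π)
guessStep-∈ s β x y π G y∈ rewrite ∈⇒memℕ y (vars G) y∈ = refl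

guessStep-∉ : ∀ s β x y π G → ¬ (y ∈ vars G) → guessStep s β x y π G ≡ guessedB s β x G π
guessStep-∉ s β x y π G y∉ rewrite ∉⇒memℕ y (vars G) y∉ = refl

module Simulation (F : CNF) (α : Assignment) (s : ℕ) (wf : WF F) (α⊨F : satB F α ≡ true) (x v : ℕ) (x≢v : x ≢ v) where
  open Pinning F α
  open PinnedClosure F α s wf α⊨F

  guess : CNF → List ℕ → Bool
  guess = guessedB s α x

  guess-∷ : ∀ P y π → guess (pin P) (y ∷ π) ≡ guessStep s α x y π (pin (sat P))
  guess-∷ P y π = cong (guessStep s α x y π) (PinClosure.result (saturation P))

  guessStep-free : ∀ P y π → y ∈ vars (pin P) → y ≢ x → guessStep s α x y π (pin P) ≡ guess (pin (dropVar P y)) π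
  guessStep-free P y π y∈ y≢x rewrite guessStep-∈ s α x y π (pin P) y∈ | ≡ᵇ-false y≢x =
    cong (λ G → guess G π) (restrict-pin P y (proj₂ (∈-vars-pin⁻ P y∈)))

  guessStep-target : ∀ P π → x ∈ vars (pin P) → guessStep s α x x π (pin P) ≡ true
  guessStep-target P π x∈ rewrite guessStep-∈ s α x x π (pin P) x∈ | ≡ᵇ-refl x = refl

  pin-⊒ : ∀ {P Q y} → P ⊒ Q → y ∈ vars (pin Q) → y ∈ vars (pin P)
  pin-⊒ {P} {Q} P⊒Q y∈ = let y∈F , Qy = ∈-vars-pin⁻ Q y∈ in ∈-vars-pin⁺ P y∈F (P⊒Q y∈F Qy)

  sat-mono : ∀ P Q → P ⊒ sat Q → sat P ⊒ sat Q
  sat-mono P Q = PinClosure.keeps (saturation P) (sat Q) (PinClosure.closed (saturation Q))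

  dropVar-mono : ∀ P Q y → P ⊒ Q → dropVar P y ⊒ dropVar Q y
  dropVar-mono P Q y P⊒Q z∈ Qz = let Qz′ , z≢y = ∧-true {Q _} Qz in cong₂ _∧_ (P⊒Q z∈ Qz′) z≢y

  dropVar-⊒-∉ : ∀ P Q y → P ⊒ Q → ¬ (y ∈ vars (pin Q)) → dropVar P y ⊒ Q
  dropVar-⊒-∉ P Q y P⊒Q y∉ {z} z∈ Qz = cong₂ _∧_ (P⊒Q z∈ Qz)
    (neq-≢ {y} {z} (λ z≡y → y∉ (subst (λ w → w ∈ vars (pin Q)) z≡y (∈-vars-pin⁺ Q z∈ Qz))))

  ∉-pin-⊒ : ∀ {P Q} → P ⊒ Q → ¬ (v ∈ vars (pin P)) → ¬ (v ∈ vars (pin Q))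
  ∉-pin-⊒ P⊒Q v∉ = v∉ ∘ pin-⊒ P⊒Q

  -- pin P is the current formula of the run on F, pin Q that of the run on F^[α(v)], which skips v.
  SimulatesOn : List ℕ → Set
  SimulatesOn π = ∀ P Q → ¬ (v ∈ vars (pin Q)) → sat P ⊒ sat Q →
    guess (pin Q) (filterᵇ (neq v) π) ≡ true → guess (pin P) π ≡ true

  module _ (π : List ℕ) (ih : SimulatesOn π) (P Q : ℕ → Bool) (v∉Q : ¬ (v ∈ vars (pin Q))) (P⊒Q : sat P ⊒ sat Q) where

    v∉Qs : ¬ (v ∈ vars (pin (sat Q)))
    v∉Qs = ∉-pin-⊒ (PinClosure.shrinks (saturation Q)) v∉Q

    simulate-v : guess (pin Q) (filterᵇ (neq v) π) ≡ true → guessStep s α x v π (pin (sat P)) ≡ true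
    simulate-v hyp with v ∈? vars (pin (sat P))
    ... | yes v∈ = trans (guessStep-free (sat P) v π v∈ (x≢v ∘ sym))
                     (ih (dropVar (sat P) v) Q v∉Q (sat-mono _ Q (dropVar-⊒-∉ _ _ v P⊒Q v∉Qs)) hyp)
    ... | no v∉ = trans (guessStep-∉ s α x v π _ v∉) (ih (sat P) Q v∉Q (sat-mono _ Q P⊒Q) hyp)

    simulate-shared : ∀ y → y ∈ vars (pin (sat Q)) →
      guessStep s α x y (filterᵇ (neq v) π) (pin (sat Q)) ≡ true → guessStep s α x y π (pin (sat P)) ≡ true
    simulate-shared y y∈Q hyp with y ℕₚ.≟ x
    ... | yes refl = guessStep-target (sat P) π (pin-⊒ P⊒Q y∈Q)
    ... | no y≢x = trans (guessStep-free (sat P) y π (pin-⊒ P⊒Q y∈Q) y≢x)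
        (ih (dropVar (sat P) y) (dropVar (sat Q) y) (∉-pin-⊒ (⊒-dropVar (sat Q) y) v∉Qs)
          (sat-mono _ _ (⊒-trans (dropVar-mono _ _ y P⊒Q) (PinClosure.shrinks (saturation (dropVar (sat Q) y)))))
          (trans (sym (guessStep-free (sat Q) y (filterᵇ (neq v) π) y∈Q y≢x)) hyp))

    simulate-extra : ∀ y → ¬ (y ∈ vars (pin (sat Q))) →
      guess (pin (sat Q)) (filterᵇ (neq v) π) ≡ true → guessStep s α x y π (pin (sat P)) ≡ true
    simulate-extra y y∉Q hyp with y ∈? vars (pin (sat P)) | y ℕₚ.≟ x
    ... | yes y∈P | yes refl = guessStep-target (sat P) π y∈P
    ... | yes y∈P | no y≢x = trans (guessStep-free (sat P) y π y∈P y≢x)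
        (ih (dropVar (sat P) y) (sat Q) v∉Qs
          (sat-mono _ _ (⊒-trans (dropVar-⊒-∉ _ _ y P⊒Q y∉Q) (PinClosure.shrinks (saturation (sat Q))))) hyp)
    ... | no y∉P | _ = trans (guessStep-∉ s α x y π _ y∉P)
        (ih (sat P) (sat Q) v∉Qs (sat-mono _ _ (⊒-trans P⊒Q (PinClosure.shrinks (saturation (sat Q))))) hyp)

  simulate : ∀ π → SimulatesOn π
  simulate [] P Q v∉Q P⊒Q ()
  simulate (y ∷ π) P Q v∉Q P⊒Q hyp = trans (guess-∷ P y π) (simulate-step (y ℕₚ.≟ v))
    where
    hyp-y : y ≢ v → guessStep s α x y (filterᵇ (neq v) π) (pin (sat Q)) ≡ true
    hyp-y y≢v = trans (sym (guess-∷ Q y (filterᵇ (neq v) π)))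
      (trans (cong (guess (pin Q)) (sym (filterᵇ-accept (neq v) {y} π (neq-≢ y≢v)))) hyp)
    simulate-step : Dec (y ≡ v) → guessStep s α x y π (pin (sat P)) ≡ true
    simulate-step (yes refl) = simulate-v π (simulate π) P Q v∉Q P⊒Q
      (trans (cong (guess (pin Q)) (sym (filterᵇ-reject (neq y) {y} π (neq-self y)))) hyp)
    simulate-step (no y≢v) with y ∈? vars (pin (sat Q))
    ... | yes y∈Q = simulate-shared π (simulate π) P Q v∉Q P⊒Q y y∈Q (hyp-y y≢v)
    ... | no y∉Q = simulate-extra π (simulate π) P Q v∉Q P⊒Q y y∉Q
        (trans (sym (guessStep-∉ s α x y (filterᵇ (neq v) π) (pin (sat Q)) y∉Q)) (hyp-y y≢v))

  guessedB-restrict-mono : ∀ π → guess (restrict (αlit α v) F) (filterᵇ (neq v) π) ≡ true → guess F π ≡ true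
  guessedB-restrict-mono π hyp = subst (λ G → guess G π ≡ true) (sym pin-allVars)
    (simulate π allVars (dropVar allVars v) v∉ (sat-mono _ _ (λ _ _ → refl))
      (subst (λ G → guess G (filterᵇ (neq v) π) ≡ true) restrict≡ hyp))
    where
    restrict≡ : restrict (αlit α v) F ≡ pin (dropVar allVars v)
    restrict≡ = trans (cong (restrict (αlit α v)) pin-allVars) (restrict-pin allVars v refl)
    v∉ : ¬ (v ∈ vars (pin (dropVar allVars v)))
    v∉ v∈ with trans (sym (proj₂ (∈-vars-pin⁻ _ v∈))) (neq-self v)
    ... | ()

concatMap-concatMap : ∀ {A B C : Set} (f : B → List C) (g : A → List B) L →
  concatMap f (concatMap g L) ≡ concatMap (λ ρ → concatMap f (g ρ)) L
concatMap-concatMap f g [] = refl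
concatMap-concatMap f g (x ∷ L) =
  trans (Listₚ.concatMap-++ f (g x) (concatMap g L)) (cong (concatMap f (g x) ++_) (concatMap-concatMap f g L))

concatMap-↭-pointwise : ∀ {A B : Set} (f g : A → List B) L → (∀ x → f x ↭ g x) → concatMap f L ↭ concatMap g L
concatMap-↭-pointwise f g [] h = Perm.refl
concatMap-↭-pointwise f g (x ∷ L) h = Permₚ.++⁺ (h x) (concatMap-↭-pointwise f g L h)

length-concatMap-const : ∀ {A B : Set} (f : A → List B) L c → (∀ {ρ} → ρ ∈ L → length (f ρ) ≡ c) →
  length (concatMap f L) ≡ length L ℕ.* c
length-concatMap-const f [] c h = refl
length-concatMap-const f (x ∷ L) c h =
  trans (Listₚ.length-++ (f x)) (cong₂ ℕ._+_ (h (here refl)) (length-concatMap-const f L c (h ∘ there)))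

module _ {A : Set} where

  concatMap-insertions-∷ : ∀ (x z : A) L →
    concatMap (insertions x) (map (z ∷_) L) ↭ map (λ σ → x ∷ z ∷ σ) L ++ map (z ∷_) (concatMap (insertions x) L)
  concatMap-insertions-∷ x z [] = Perm.refl
  concatMap-insertions-∷ x z (σ ∷ L) = prep (x ∷ z ∷ σ)
    (↭-trans (Permₚ.++⁺ˡ (map (z ∷_) (insertions x σ)) (concatMap-insertions-∷ x z L))
    (↭-trans (Permₚ.shifts (map (z ∷_) (insertions x σ)) (map (λ σ → x ∷ z ∷ σ) L))
    (↭-reflexive (cong (map (λ σ → x ∷ z ∷ σ) L ++_) (sym (Listₚ.map-++ (z ∷_) (insertions x σ) (concatMap (insertions x) L)))))))

  insertions-comm : ∀ (x y : A) ρ → concatMap (insertions x) (insertions y ρ) ↭ concatMap (insertions y) (insertions x ρ)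
  insertions-comm x y [] = swap (x ∷ y ∷ []) (y ∷ x ∷ []) Perm.refl
  insertions-comm x y (z ∷ r) = ↭-trans x-then-y (↭-trans (swap _ _ middle) (↭-sym y-then-x))
    where
    Ay : List (List A)
    Ay = map (y ∷_) (map (z ∷_) (insertions x r))
    By : List (List A)
    By = map (λ σ → y ∷ z ∷ σ) (insertions x r)
    Ax : List (List A)
    Ax = map (x ∷_) (map (z ∷_) (insertions y r))
    Mx : List (List A)
    Mx = map (z ∷_) (concatMap (insertions x) (insertions y r))
    My : List (List A)
    My = map (z ∷_) (concatMap (insertions y) (insertions x r))
    x-then-y : concatMap (insertions x) (insertions y (z ∷ r)) ↭ (x ∷ y ∷ z ∷ r) ∷ (y ∷ x ∷ z ∷ r) ∷ (By ++ (Ax ++ Mx))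
    x-then-y = prep _ (prep _ (↭-trans (Permₚ.++⁺ˡ Ay (concatMap-insertions-∷ x z (insertions y r)))
      (↭-reflexive (cong₂ (λ a b → a ++ (b ++ Mx)) (sym (Listₚ.map-∘ (insertions x r))) (Listₚ.map-∘ (insertions y r))))))
    middle : By ++ (Ax ++ Mx) ↭ Ax ++ (By ++ My)
    middle = ↭-trans (Permₚ.shifts By Ax) (Permₚ.++⁺ˡ Ax (Permₚ.++⁺ˡ By (Permₚ.map⁺ (z ∷_) (insertions-comm x y r))))
    y-then-x : concatMap (insertions y) (insertions x (z ∷ r)) ↭ (y ∷ x ∷ z ∷ r) ∷ (x ∷ y ∷ z ∷ r) ∷ (Ax ++ (By ++ My))
    y-then-x = prep _ (prep _ (Permₚ.++⁺ˡ Ax (concatMap-insertions-∷ y z (insertions x r))))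

  perms-↭ : ∀ {xs ys : List A} → xs ↭ ys → perms xs ↭ perms ys
  perms-↭ Perm.refl = Perm.refl
  perms-↭ (prep x p) = concatMap-↭ (insertions x) (perms-↭ p)
  perms-↭ {x ∷ y ∷ xs} {.y ∷ .x ∷ ys} (swap .x .y p) =
    ↭-trans (concatMap-↭ (insertions x) (concatMap-↭ (insertions y) (perms-↭ p)))
    (↭-trans (↭-reflexive (concatMap-concatMap (insertions x) (insertions y) (perms ys)))
    (↭-trans (concatMap-↭-pointwise _ _ (perms ys) (insertions-comm x y))
    (↭-reflexive (sym (concatMap-concatMap (insertions y) (insertions x) (perms ys))))))
  perms-↭ (Perm.trans p q) = Perm.trans (perms-↭ p) (perms-↭ q)

  length-insertions : ∀ (x : A) ρ → length (insertions x ρ) ≡ suc (length ρ)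
  length-insertions x [] = refl
  length-insertions x (y ∷ ys) = cong suc (trans (Listₚ.length-map (y ∷_) (insertions x ys)) (length-insertions x ys))

  ∈-insertions⇒↭ : ∀ (x : A) ρ {π} → π ∈ insertions x ρ → π ↭ x ∷ ρ
  ∈-insertions⇒↭ x [] (here refl) = Perm.refl
  ∈-insertions⇒↭ x (z ∷ r) (here refl) = Perm.refl
  ∈-insertions⇒↭ x (z ∷ r) (there m) with ∈-map⁻ (z ∷_) m
  ... | π′ , π′∈ , refl = ↭-trans (prep z (∈-insertions⇒↭ x r π′∈)) (swap z x Perm.refl)

  ∈-perms⇒↭ : ∀ xs {ρ : List A} → ρ ∈ perms xs → ρ ↭ xs
  ∈-perms⇒↭ [] (here refl) = Perm.refl
  ∈-perms⇒↭ (x ∷ xs) π∈ with find (∈-concatMap⁻ (insertions x) {xs = perms xs} π∈)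
  ... | ρ , ρ∈ , π∈ins = ↭-trans (∈-insertions⇒↭ x ρ π∈ins) (prep x (∈-perms⇒↭ xs ρ∈))

  length-perms-∷ : ∀ (x : A) xs → length (perms (x ∷ xs)) ≡ length (perms xs) ℕ.* suc (length xs)
  length-perms-∷ x xs = length-concatMap-const (insertions x) (perms xs) (suc (length xs))
    (λ {ρ} ρ∈ → trans (length-insertions x ρ) (cong suc (Permₚ.↭-length (∈-perms⇒↭ xs ρ∈))))

  length-perms-nonZero : ∀ (xs : List A) → ∃ λ d → length (perms xs) ≡ suc d
  length-perms-nonZero [] = 0 , refl
  length-perms-nonZero (x ∷ xs) with length-perms-nonZero xs
  ... | d , e = length xs ℕ.+ d ℕ.* suc (length xs) , trans (length-perms-∷ x xs) (cong (ℕ._* suc (length xs)) e)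

insertions-filterᵇ-neq : ∀ v ρ {π} → π ∈ insertions v ρ → filterᵇ (neq v) π ≡ filterᵇ (neq v) ρ
insertions-filterᵇ-neq v [] (here refl) rewrite neq-self v = refl
insertions-filterᵇ-neq v (z ∷ r) (here refl) rewrite neq-self v = refl
insertions-filterᵇ-neq v (z ∷ r) (there m) with ∈-map⁻ (z ∷_) m
... | π′ , π′∈ , refl with neq v z
... | true = cong (z ∷_) (insertions-filterᵇ-neq v r π′∈)
... | false = insertions-filterᵇ-neq v r π′∈

countTrue-↭ : ∀ {bs cs} → bs ↭ cs → countTrue bs ≡ countTrue cs
countTrue-↭ Perm.refl = refl
countTrue-↭ (prep true p) = cong suc (countTrue-↭ p)
countTrue-↭ (prep false p) = countTrue-↭ p
countTrue-↭ (swap true true p) = cong (suc ∘ suc) (countTrue-↭ p)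
countTrue-↭ (swap true false p) = cong suc (countTrue-↭ p)
countTrue-↭ (swap false true p) = cong suc (countTrue-↭ p)
countTrue-↭ (swap false false p) = countTrue-↭ p
countTrue-↭ (Perm.trans p q) = trans (countTrue-↭ p) (countTrue-↭ q)

countTrue-++ : ∀ as bs → countTrue (as ++ bs) ≡ countTrue as ℕ.+ countTrue bs
countTrue-++ [] bs = refl
countTrue-++ (true ∷ as) bs = cong suc (countTrue-++ as bs)
countTrue-++ (false ∷ as) bs = countTrue-++ as bs

countTrue-all : ∀ {A : Set} (g : A → Bool) L → (∀ {π} → π ∈ L → g π ≡ true) → countTrue (map g L) ≡ length L
countTrue-all g [] h = refl
countTrue-all g (x ∷ L) h rewrite h (here refl) = cong suc (countTrue-all g L (h ∘ there))

countTrue-insertions : ∀ {A : Set} (g g′ : List A → Bool) v n L →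
  (∀ {ρ} → ρ ∈ L → length (insertions v ρ) ≡ n) →
  (∀ {ρ π} → ρ ∈ L → π ∈ insertions v ρ → g′ ρ ≡ true → g π ≡ true) →
  n ℕ.* countTrue (map g′ L) ℕ.≤ countTrue (map g (concatMap (insertions v) L))
countTrue-insertions g g′ v n [] h₁ h₂ = ℕₚ.≤-reflexive (ℕₚ.*-zeroʳ n)
countTrue-insertions g g′ v n (ρ ∷ L) h₁ h₂
  rewrite Listₚ.map-++ g (insertions v ρ) (concatMap (insertions v) L)
        | countTrue-++ (map g (insertions v ρ)) (map g (concatMap (insertions v) L)) with g′ ρ in g′ρ
... | true = ℕₚ.≤-trans (ℕₚ.≤-reflexive (ℕₚ.*-suc n _))
    (ℕₚ.+-mono-≤ (ℕₚ.≤-reflexive (sym (trans (countTrue-all g (insertions v ρ) (λ π∈ → h₂ (here refl) π∈ g′ρ)) (h₁ (here refl)))))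
                 (countTrue-insertions g g′ v n L (h₁ ∘ there) (h₂ ∘ there)))
... | false = ℕₚ.≤-trans (countTrue-insertions g g′ v n L (h₁ ∘ there) (h₂ ∘ there)) (ℕₚ.m≤n+m _ _)

ratio-≤-scale : ∀ n a b A B → (∃ λ d → A ≡ suc d) → (∃ λ e → B ≡ suc e) →
  n ℕ.* a ℕ.≤ b → B ≡ A ℕ.* n → ratio a A ≤ ratio b B
ratio-≤-scale n a b .(suc d) .(suc e) (d , refl) (e , refl) na≤b B≡An = ratio-≤ a d b e (begin
  a ℕ.* suc e             ≡⟨ cong (a ℕ.*_) B≡An ⟩
  a ℕ.* (suc d ℕ.* n)     ≡⟨ cong (a ℕ.*_) (ℕₚ.*-comm (suc d) n) ⟩
  a ℕ.* (n ℕ.* suc d)     ≡⟨ ℕₚ.*-assoc a n (suc d) ⟨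
  a ℕ.* n ℕ.* suc d       ≤⟨ ℕₚ.*-monoˡ-≤ (suc d) (subst (ℕ._≤ b) (ℕₚ.*-comm n a) na≤b) ⟩
  b ℕ.* suc d             ∎)
  where open ℕₚ.≤-Reasoning

pAux-Agree : ∀ n G a b → Agree (vars G) a b → pAux n G a ≡ pAux n G b
pAux-Agree n (cnf cs []) a b ag = refl
pAux-Agree zero (cnf cs (y ∷ ys)) a b ag = refl
pAux-Agree (suc n) G@(cnf cs (y ∷ ys)) a b ag = sumℚ-cong _ _ (SL G) same
  where
  same : ∀ {l} → l ∈ SL G → (if litTrue a l then ratio 1 (length (SL G)) * pAux n (restrict l G) a else 0ℚ)
                           ≡ (if litTrue b l then ratio 1 (length (SL G)) * pAux n (restrict l G) b else 0ℚ)
  same {l} l∈ = cong₂ (λ t z → if t then ratio 1 (length (SL G)) * z else 0ℚ) (litTrue-Agree l (proj₁ (∈-SL⁻ G l∈)) ag)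
    (pAux-Agree n (restrict l G) a b (Agree-⊆ (proj₁ ∘ vars-restrict-∈ l G) ag))

p-Agree : ∀ G a b → Agree (vars G) a b → p G a ≡ p G b
p-Agree G = pAux-Agree _ G

guessedB-Agree : ∀ s x π G a b → Agree (vars G) a b → guessedB s a x G π ≡ guessedB s b x G π
guessedB-Agree s x [] G a b ag = refl
guessedB-Agree s x (y ∷ π) G a b ag = step (y ∈? vars G′)
  where
  G′ : CNF
  G′ = saturate s G
  ag′ : Agree (vars G′) a b
  ag′ = Agree-⊆ (vars-closure-⊆ s (length (vars G)) G) ag
  step : Dec (y ∈ vars G′) → guessStep s a x y π G′ ≡ guessStep s b x y π G′
  step (yes y∈) rewrite guessStep-∈ s a x y π G′ y∈ | guessStep-∈ s b x y π G′ y∈ | ag′ y∈ =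
    cong (if y ≡ᵇ x then true else_)
      (guessedB-Agree s x π (restrict (lit y (b y)) G′) a b (Agree-⊆ (proj₁ ∘ vars-restrict-∈ (lit y (b y)) G′) ag′))
  step (no y∉) = trans (guessStep-∉ s a x y π G′ y∉)
    (trans (guessedB-Agree s x π G′ a b ag′) (sym (guessStep-∉ s b x y π G′ y∉)))

pGuessed-∈ : ∀ s G x a → x ∈ vars G →
  pGuessed s G x a ≡ ratio (countTrue (map (guessedB s a x G) (perms (vars G)))) (length (perms (vars G)))
pGuessed-∈ s G x a x∈ rewrite ∈⇒memℕ x (vars G) x∈ = refl

pGuessed-Agree : ∀ s G x a b → Agree (vars G) a b → pGuessed s G x a ≡ pGuessed s G x b
pGuessed-Agree s G x a b ag = cong (λ c → if memℕ x (vars G) then ratio c (length (perms (vars G))) else 0ℚ)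
  (cong countTrue (Listₚ.map-cong-local {xs = perms (vars G)} (All.tabulate (λ {π} _ → guessedB-Agree s x π G a b ag))))

pGuessed-nonNeg : ∀ s G x a → 0ℚ ≤ pGuessed s G x a
pGuessed-nonNeg s G x a with memℕ x (vars G)
... | true = ratio-nonNeg (countTrue (map (guessedB s a x G) (perms (vars G)))) (length (perms (vars G)))
... | false = ℚₚ.≤-refl

pGuessed-restrict-mono : ∀ s F α v x → WF F → satB F α ≡ true → v ∈ vars F → x ∈ vars F → x ≢ v →
  pGuessed s (restrict (αlit α v) F) x α ≤ pGuessed s F x α
pGuessed-restrict-mono s F α v x wf α⊨F v∈ x∈ x≢v
  rewrite pGuessed-∈ s F x α x∈ | pGuessed-∈ s (restrict (αlit α v) F) x α (∈-vars-restrict (αlit α v) F x∈ x≢v) =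
  ratio-≤-scale n c′ c L′ L (length-perms-nonZero V′) (length-perms-nonZero V) n*c′≤c
    (trans (Permₚ.↭-length (perms-↭ V↭)) (length-perms-∷ v V′))
  where
  Fv : CNF
  Fv = restrict (αlit α v) F
  V : List ℕ
  V = vars F
  V′ : List ℕ
  V′ = filterᵇ (neq v) V
  n : ℕ
  n = suc (length V′)
  c′ : ℕ
  c′ = countTrue (map (guessedB s α x Fv) (perms V′))
  c : ℕ
  c = countTrue (map (guessedB s α x F) (perms V))
  L′ : ℕ
  L′ = length (perms V′)
  L : ℕ
  L = length (perms V)
  V↭ : V ↭ v ∷ V′
  V↭ = ↭-extract V v∈ (proj₁ wf)
  v∉ρ : ∀ {ρ} → ρ ∈ perms V′ → filterᵇ (neq v) ρ ≡ ρ
  v∉ρ ρ∈ = filterᵇ-all (neq v) _ (λ y∈ρ → neq-≢ (proj₂ (vars-restrict-∈ (αlit α v) F (Permₚ.∈-resp-↭ (∈-perms⇒↭ V′ ρ∈) y∈ρ))))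
  n*c′≤c : n ℕ.* c′ ℕ.≤ c
  n*c′≤c = subst (n ℕ.* c′ ℕ.≤_) (sym (countTrue-↭ (Permₚ.map⁺ (guessedB s α x F) (perms-↭ V↭))))
    (countTrue-insertions (guessedB s α x F) (guessedB s α x Fv) v n (perms V′)
      (λ {ρ} ρ∈ → trans (length-insertions v ρ) (cong suc (Permₚ.↭-length (∈-perms⇒↭ V′ ρ∈))))
      (λ {ρ} {π} ρ∈ π∈ guessed → Simulation.guessedB-restrict-mono F α s wf α⊨F x v x≢v π
        (trans (cong (guessedB s α x Fv) (trans (insertions-filterᵇ-neq v ρ π∈) (v∉ρ ρ∈))) guessed)))

-- The cost

AllAgreeOn : CNF → ℕ → Set
AllAgreeOn G x = ∀ a b → satB G a ≡ true → satB G b ≡ true → a x ≡ b x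

satList-representative : ∀ G a → WellScoped G → satB G a ≡ true → ∃ λ a′ → (a′ ∈ satList G) × Agree (vars G) a′ a
satList-representative G a ws s with allAssign-complete (vars G) a
... | a′ , a′∈ , ag = a′ , ∈-filterᵇ⁺ (satB G) _ a′∈ (trans (satB-Agree G ws ag) s) , ag

frozenB⁻ : ∀ G x → WellScoped G → frozenB G x ≡ true → (x ∈ vars G) × AllAgreeOn G x
frozenB⁻ G x ws e with ∧-true {memℕ x (vars G)} e
... | x∈? , agree = x∈ , all-agree
  where
  x∈ : x ∈ vars G
  x∈ = memℕ⇒∈ x (vars G) x∈?
  all-agree : AllAgreeOn G x
  all-agree a b sa sb with satList-representative G a ws sa | satList-representative G b ws sb
  ... | a′ , a′∈ , a′≈a | b′ , b′∈ , b′≈b =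
    trans (sym (a′≈a x∈)) (trans (beq-true (all⁻ _ (satList G) (all⁻ _ (satList G) agree a′∈) b′∈)) (b′≈b x∈))

frozenB⁺ : ∀ G x → x ∈ vars G → AllAgreeOn G x → frozenB G x ≡ true
frozenB⁺ G x x∈ agree = cong₂ _∧_ (∈⇒memℕ x (vars G) x∈)
  (all⁺ _ (satList G) λ {a} a∈ → all⁺ _ (satList G) λ {b} b∈ →
    trans (cong (λ t → beq t (b x)) (agree a b (proj₂ (∈-filterᵇ⁻ (satB G) (allAssign (vars G)) a∈))
                                                (proj₂ (∈-filterᵇ⁻ (satB G) (allAssign (vars G)) b∈))))
          (beq-refl (b x)))

sumℚ-concatMap-pair : ∀ {A B : Set} (h : B → ℚ) (a b : A → B) L →
  sumℚ (map h (concatMap (λ f → a f ∷ b f ∷ []) L)) ≡ sumℚ (map (λ f → h (a f) + h (b f)) L)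
sumℚ-concatMap-pair h a b [] = refl
sumℚ-concatMap-pair h a b (f ∷ L) =
  trans (sym (ℚₚ.+-assoc (h (a f)) (h (b f)) _)) (cong ((h (a f) + h (b f)) +_) (sumℚ-concatMap-pair h a b L))

DependsOn : List ℕ → (Assignment → ℚ) → Set
DependsOn V h = ∀ a b → Agree V a b → h a ≡ h b

update-Agree : ∀ y ys b f f′ → Agree ys f f′ → Agree (y ∷ ys) (update y b f) (update y b f′)
update-Agree y ys b f f′ ag {z} z∈ with z ≡ᵇ y in e
... | true = refl
update-Agree y ys b f f′ ag {z} (here refl) | false = ⊥-elim (≡ᵇ-false⇒≢ {z} {z} e refl)
update-Agree y ys b f f′ ag {z} (there z∈) | false = ag z∈

update-comm : ∀ {y v} → y ≢ v → ∀ b c f z → update v c (update y b f) z ≡ update y b (update v c f) z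
update-comm {y} {v} y≢v b c f z with z ≡ᵇ v in e₁ | z ≡ᵇ y in e₂
... | true | true = ⊥-elim (y≢v (trans (sym (≡ᵇ-true {z} {y} e₂)) (≡ᵇ-true {z} {v} e₁)))
... | true | false = refl
... | false | true = refl
... | false | false = refl

sumℚ-allAssign-split : ∀ V {v} (h : Assignment → ℚ) → v ∈ V → Unique V → DependsOn V h →
  sumℚ (map h (allAssign V)) ≡ sumℚ (map (λ γ → h (update v false γ) + h (update v true γ)) (allAssign (filterᵇ (neq v) V)))
sumℚ-allAssign-split (y ∷ ys) h (here refl) u _ =
  trans (sumℚ-concatMap-pair h (update y false) (update y true) (allAssign ys))
    (cong (λ W → sumℚ (map (λ γ → h (update y false γ) + h (update y true γ)) (allAssign W))) (sym (filterᵇ-neq-head u)))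
sumℚ-allAssign-split (y ∷ ys) {v} h (there v∈) (y≢ ∷ u) dep = begin
  sumℚ (map h (allAssign (y ∷ ys)))                                     ≡⟨ sumℚ-concatMap-pair h (update y false) (update y true) (allAssign ys) ⟩
  sumℚ (map (λ f → h (update y false f) + h (update y true f)) (allAssign ys))
    ≡⟨ sumℚ-+ (λ f → h (update y false f)) (λ f → h (update y true f)) (allAssign ys) ⟩
  sumℚ (map (λ f → h (update y false f)) (allAssign ys)) + sumℚ (map (λ f → h (update y true f)) (allAssign ys))
    ≡⟨ cong₂ _+_ (sumℚ-allAssign-split ys _ v∈ u (dep-update false)) (sumℚ-allAssign-split ys _ v∈ u (dep-update true)) ⟩
  sumℚ (map (λ f → h (update y false (update v false f)) + h (update y false (update v true f))) (allAssign W)) +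
  sumℚ (map (λ f → h (update y true (update v false f)) + h (update y true (update v true f))) (allAssign W))
    ≡⟨ sumℚ-+ _ _ (allAssign W) ⟨
  sumℚ (map (λ f → (h (update y false (update v false f)) + h (update y false (update v true f))) +
                   (h (update y true (update v false f)) + h (update y true (update v true f)))) (allAssign W))
    ≡⟨ sumℚ-cong _ _ (allAssign W) (λ {f} _ → cong₂ _+_ (cong₂ _+_ (swap-updates false false f) (swap-updates false true f))
                                                          (cong₂ _+_ (swap-updates true false f) (swap-updates true true f))) ⟩
  sumℚ (map (λ f → k (update y false f) + k (update y true f)) (allAssign W))
    ≡⟨ sumℚ-concatMap-pair k (update y false) (update y true) (allAssign W) ⟨
  sumℚ (map k (allAssign (y ∷ W)))                                      ≡⟨ cong (λ Z → sumℚ (map k (allAssign Z))) (filterᵇ-accept (neq v) {y} ys (neq-≢ y≢v)) ⟨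
  sumℚ (map k (allAssign (filterᵇ (neq v) (y ∷ ys))))                   ∎
  where
  open ≡-Reasoning
  y≢v : y ≢ v
  y≢v = All.lookup y≢ v∈
  W : List ℕ
  W = filterᵇ (neq v) ys
  k : Assignment → ℚ
  k γ = h (update v false γ) + h (update v true γ)
  dep-update : ∀ b → DependsOn ys (λ f → h (update y b f))
  dep-update b f f′ ag = dep _ _ (update-Agree y ys b f f′ ag)
  swap-updates : ∀ b c f → h (update y b (update v c f)) ≡ h (update v c (update y b f))
  swap-updates b c f = dep _ _ (λ {z} _ → sym (update-comm y≢v b c f z))

module CostMonotone (s : ℕ) (F : CNF) (wf : WF F) (α : Assignment) (α⊨F : satB F α ≡ true) (v : ℕ) (frozen : Frozen F v) where

  l : Lit
  l = αlit α v
  Fv : CNF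
  Fv = restrict l F
  V : List ℕ
  V = vars F
  ws : WellScoped F
  ws = WF⇒WellScoped wf
  v∈ : v ∈ V
  v∈ = proj₁ frozen

  -- summand of the frozen case of c(G, y), extended by 0 to unsatisfying γ
  weight : CNF → ℕ → Assignment → ℚ
  weight G y γ = if satB G γ then p G γ * pGuessed s G y γ else 0ℚ

  weight-nonNeg : ∀ G y γ → 0ℚ ≤ weight G y γ
  weight-nonNeg G y γ with satB G γ
  ... | true = *-nonNeg (p-nonNeg G γ) (pGuessed-nonNeg s G y γ)
  ... | false = ℚₚ.≤-refl

  weight-DependsOn : ∀ y → DependsOn V (weight F y)
  weight-DependsOn y a b ag =
    cong₂ (λ t z → if t then z else 0ℚ) (satB-Agree F ws ag) (cong₂ _*_ (p-Agree F a b ag) (pGuessed-Agree s F y a b ag))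

  frozen-value : ∀ a → satB F a ≡ true → a v ≡ α v
  frozen-value a sa = proj₂ frozen a α (≡→T sa) (≡→T α⊨F)

  Agree-update : ∀ γ → Agree (vars Fv) γ (update v (α v) γ)
  Agree-update γ z∈ = sym (update-≢ (α v) γ (proj₂ (vars-restrict-∈ l F z∈)))

  satB-restrict-update : ∀ γ → satB Fv γ ≡ satB F (update v (α v) γ)
  satB-restrict-update γ = Bool-ext (satB-update F γ l) back
    where
    back : satB F (update v (α v) γ) ≡ true → satB Fv γ ≡ true
    back e = trans (satB-Agree Fv (restrict-WellScoped l F ws) (Agree-update γ))
      (satB-restrict F (update v (α v) γ) l e (trans (cong (λ t → beq t (α v)) (update-≡ v (α v) γ)) (beq-refl (α v))))

  weight-flipped : ∀ y γ → weight F y (update v (not (α v)) γ) ≡ 0ℚ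
  weight-flipped y γ with satB F (update v (not (α v)) γ) in sat
  ... | true = ⊥-elim (not-≢-self (α v) (trans (sym (update-≡ v (not (α v)) γ)) (frozen-value (update v (not (α v)) γ) sat)))
  ... | false = refl

  weight-sat : ∀ G y γ → satB G γ ≡ true → weight G y γ ≡ p G γ * pGuessed s G y γ
  weight-sat G y γ sat rewrite sat = refl

  weight-restrict-≤ : ∀ y γ → y ∈ vars Fv → weight Fv y γ ≤ weight F y (update v (α v) γ)
  weight-restrict-≤ y γ y∈ with satB Fv γ in satv
  ... | false = weight-nonNeg F y _
  ... | true = subst (p Fv γ * pGuessed s Fv y γ ≤_) (sym (weight-sat F y γ′ sat′)) (begin
    p Fv γ * pGuessed s Fv y γ     ≡⟨ cong₂ _*_ (p-Agree Fv _ _ (Agree-update γ)) (pGuessed-Agree s Fv y _ _ (Agree-update γ)) ⟩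
    p Fv γ′ * pGuessed s Fv y γ′   ≡⟨ cong (λ G → p G γ′ * pGuessed s G y γ′) Fv≡ ⟩
    p Fv′ γ′ * pGuessed s Fv′ y γ′ ≡⟨ cong (_* pGuessed s Fv′ y γ′) (p-restrict-frozen _ F refl wf γ′ sat′ v frozen) ⟩
    p F γ′ * pGuessed s Fv′ y γ′   ≤⟨ *-monoʳ-≤-0≤ (p-nonNeg F γ′) (pGuessed-restrict-mono s F γ′ v y wf sat′ v∈ y∈V y≢v) ⟩
    p F γ′ * pGuessed s F y γ′     ∎)
    where
    open ℚₚ.≤-Reasoning
    γ′ : Assignment
    γ′ = update v (α v) γ
    sat′ : satB F γ′ ≡ true
    sat′ = trans (sym (satB-restrict-update γ)) satv
    Fv′ : CNF
    Fv′ = restrict (αlit γ′ v) F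
    Fv≡ : Fv ≡ Fv′
    Fv≡ = cong (λ b → restrict (lit v b) F) (sym (update-≡ v (α v) γ))
    y∈V : y ∈ V
    y∈V = proj₁ (vars-restrict-∈ l F y∈)
    y≢v = proj₂ (vars-restrict-∈ l F y∈)

  weight-restrict-≤-pair : ∀ y γ → y ∈ vars Fv → weight Fv y γ ≤ weight F y (update v false γ) + weight F y (update v true γ)
  weight-restrict-≤-pair y γ y∈ = by-value (α v) refl
    where
    at : ∀ {b} → α v ≡ b → weight Fv y γ ≤ weight F y (update v b γ)
    at αv = subst (λ t → weight Fv y γ ≤ weight F y (update v t γ)) αv (weight-restrict-≤ y γ y∈)
    flipped : ∀ {b} → α v ≡ b → weight F y (update v (not b) γ) ≡ 0ℚ
    flipped αv = trans (cong (λ t → weight F y (update v (not t) γ)) (sym αv)) (weight-flipped y γ)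
    by-value : ∀ b → α v ≡ b → weight Fv y γ ≤ weight F y (update v false γ) + weight F y (update v true γ)
    by-value false αv = ℚₚ.≤-trans (at αv) (ℚₚ.≤-reflexive (trans (sym (ℚₚ.+-identityʳ (weight F y (update v false γ)))) (cong (weight F y (update v false γ) +_) (sym (flipped αv)))))
    by-value true αv = ℚₚ.≤-trans (at αv) (ℚₚ.≤-reflexive (trans (sym (ℚₚ.+-identityˡ (weight F y (update v true γ)))) (cong (_+ weight F y (update v true γ)) (sym (flipped αv)))))

  frozenSum : CNF → ℕ → ℚ
  frozenSum G y = sumℚ (map (λ γ → p G γ * pGuessed s G y γ) (satList G))

  frozenSum-restrict-≤ : ∀ y → y ∈ vars Fv → frozenSum Fv y ≤ frozenSum F y
  frozenSum-restrict-≤ y y∈ = begin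
    frozenSum Fv y                                                        ≡⟨ sumℚ-filterᵇ _ (satB Fv) (allAssign (vars Fv)) ⟩
    sumℚ (map (weight Fv y) (allAssign (vars Fv)))                        ≤⟨ sumℚ-mono _ _ (allAssign (vars Fv)) (λ {γ} _ → weight-restrict-≤-pair y γ y∈) ⟩
    sumℚ (map (λ γ → weight F y (update v false γ) + weight F y (update v true γ)) (allAssign (vars Fv)))
                                                                          ≡⟨ sumℚ-allAssign-split V (weight F y) v∈ (proj₁ wf) (weight-DependsOn y) ⟨
    sumℚ (map (weight F y) (allAssign V))                                 ≡⟨ sumℚ-filterᵇ _ (satB F) (allAssign V) ⟨
    frozenSum F y                                                         ∎
    where open ℚₚ.≤-Reasoning

  frozenB-restrict : ∀ y → y ∈ vars Fv → frozenB Fv y ≡ frozenB F y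
  frozenB-restrict y y∈ = Bool-ext (λ e → frozenB⁺ F y y∈V (to e)) (λ e → frozenB⁺ Fv y y∈ (from e))
    where
    y∈V : y ∈ V
    y∈V = proj₁ (vars-restrict-∈ l F y∈)
    y≢v = proj₂ (vars-restrict-∈ l F y∈)
    l-true : ∀ a → satB F a ≡ true → litTrue a l ≡ true
    l-true a sa = trans (cong (λ t → beq t (α v)) (frozen-value a sa)) (beq-refl (α v))
    to : frozenB Fv y ≡ true → AllAgreeOn F y
    to e a b sa sb = proj₂ (frozenB⁻ Fv y (restrict-WellScoped l F ws) e) a b
      (satB-restrict F a l sa (l-true a sa)) (satB-restrict F b l sb (l-true b sb))
    from : frozenB F y ≡ true → AllAgreeOn Fv y
    from e a b sa sb = trans (sym (update-≢ (α v) a y≢v))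
      (trans (proj₂ (frozenB⁻ F y ws e) (update v (α v) a) (update v (α v) b) (satB-update F a l sa) (satB-update F b l sb)) (update-≢ (α v) b y≢v))

  costVar-∈ : ∀ S G y → y ∈ vars G → costVar S s G y ≡ (if frozenB G y then frozenSum G y else S)
  costVar-∈ S G y y∈ rewrite ∈⇒memℕ y (vars G) y∈ = refl

  costVar-restrict-≤ : ∀ S y → y ∈ vars Fv → costVar S s Fv y ≤ costVar S s F y
  costVar-restrict-≤ S y y∈ = subst₂ _≤_ (sym (costVar-∈ S Fv y y∈)) (sym (costVar-∈ S F y (proj₁ (vars-restrict-∈ l F y∈)))) compare
    where
    compare : (if frozenB Fv y then frozenSum Fv y else S) ≤ (if frozenB F y then frozenSum F y else S)
    compare with frozenB Fv y | frozenB F y | frozenB-restrict y y∈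
    ... | true | true | _ = frozenSum-restrict-≤ y y∈
    ... | false | false | _ = ℚₚ.≤-refl

  costVar-nonNeg : ∀ S → 0ℚ ≤ S → 0ℚ ≤ costVar S s F v
  costVar-nonNeg S 0≤S = subst (0ℚ ≤_) (sym (costVar-∈ S F v v∈)) by-frozenness
    where
    by-frozenness : 0ℚ ≤ (if frozenB F v then frozenSum F v else S)
    by-frozenness with frozenB F v
    ... | true = sumℚ-nonNeg _ (satList F) (λ {γ} _ → *-nonNeg (p-nonNeg F γ) (pGuessed-nonNeg s F v γ))
    ... | false = 0≤S

  cost-restrict-≤ : ∀ S → 0ℚ ≤ S → cost S s Fv ≤ cost S s F
  cost-restrict-≤ S 0≤S = begin
    cost S s Fv                                                       ≤⟨ sumℚ-mono _ _ (vars Fv) (λ {y} y∈ → costVar-restrict-≤ S y y∈) ⟩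
    sumℚ (map (costVar S s F) (vars Fv))                              ≤⟨ ℚₚ.≤-trans (ℚₚ.≤-reflexive (sym (ℚₚ.+-identityˡ _)))
                                                                           (ℚₚ.+-monoˡ-≤ _ (costVar-nonNeg S 0≤S)) ⟩
    costVar S s F v + sumℚ (map (costVar S s F) (vars Fv))            ≡⟨ sumℚ-extract (costVar S s F) V v∈ (proj₁ wf) ⟨
    cost S s F                                                        ∎
    where open ℚₚ.≤-Reasoning

lemma3 : (k : ℕ) → 3 ℕ.≤ k → (s : ℕ) → (S : ℚ) →
    (∀ G → WF G → IsKCNF k G → Satisfiable G →
      ∀ x → Frozen G x → ∀ β → Sat G β → pGuessed s G x β ≤ S) →
    ∀ F → WF F → Satisfiable F → ∀ α → Sat F α →
    ∀ l → var l ∈ vars F → LitIn l α →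
    (p F α ≤ p (restrict l F) α) ×
    (Frozen F (var l) →
      (p (restrict l F) α ≡ p F α) ×
      (IsKCNF k F → cost S s (restrict l F) ≤ cost S s F))
lemma3 k _ s S pGuessed≤S F wf satisfiable α α⊨F (lit x b) x∈ l∈α with beq-true {α x} {b} (T→≡ l∈α)
... | refl = p-restrict-mono _ F refl wf α (T→≡ α⊨F) x x∈ , λ frozen →
  p-restrict-frozen _ F refl wf α (T→≡ α⊨F) x frozen ,
  λ kcnf → CostMonotone.cost-restrict-≤ s F wf α (T→≡ α⊨F) x frozen S
    (ℚₚ.≤-trans (pGuessed-nonNeg s F x α) (pGuessed≤S F wf kcnf satisfiable x frozen α α⊨F))
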